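{- Let $n\ge 2$ and $\mathfrak S=\mathcal P(\{1,\dots,n\})\setminus\{\emptyset,\{1,\dots,n\}\}$. Droste's construction for $\mathfrak S$, which has pixel expansion $\sum_{T\in\mathfrak S}2^{|T|-1}=\frac12(3^n-1)-2^{n-1}$, is optimal (i.e. every $\mathfrak S$-extended visual cryptography scheme with $l_T<h_T$ for all $T\in\mathfrak S$ has pixel expansion at least $\frac12(3^n-1)-2^{n-1}$) if and only if $n$ is odd. In particular, for $n$ even there exists an $\mathfrak S$-extended visual cryptography scheme with $l_T<h_T$ for all $T\in\mathfrak S$ and pixel expansion strictly less than $\frac12(3^n-1)-2^{n-1}$.
   Context: Let $\mathfrak S\subseteq\mathcal P(\{1,\dots,n\})\setminus\{\emptyset\}$ be nonempty. An $\mathfrak S$-extended visual cryptography scheme with $n$ transparencies and pixel expansion $m$ consists of integers $0\le l_T\le h_T\le m$ for $T\in\mathfrak S$, together with, for every $\mathfrak T\subseteq\mathfrak S$, a nonempty multiset $C^{\mathfrak T}$ of $n\times m$ Boolean matrices, such that: (1) for every $B\in C^{\mathfrak T}$ and every $\{i_1,\dots,i_q\}\in\mathfrak S$, the Hamming weight of the Boolean OR of rows $i_1,\dots,i_q$ of $B$ equals $h_{\{i_1,\dots,i_q\}}$ if $\{i_1,\dots,i_q\}\in\mathfrak T$ and $l_{\{i_1,\dots,i_q\}}$ otherwise; (2) for every $Q\subseteq\{1,\dots,n\}$ and all $\mathfrak T,\mathfrak T'\subseteq\mathfrak S$ with $\mathfrak T\cap\mathcal P(Q)=\mathfrak T'\cap\mathcal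 P(Q)$, restricting the matrices of $C^{\mathfrak T}$ and of $C^{\mathfrak T'}$ to the rows indexed by $Q$ yields the same multiset. Droste's construction: for each $T\in\mathfrak S$ one uses $2^{|T|-1}$ subpixels forming a $(|T|,|T|)$-threshold visual cryptography scheme among the transparencies in $T$, these subpixels being always black on transparencies $i\notin T$; its pixel expansion is $\sum_{T\in\mathfrak S}2^{|T|-1}$ and all images have $h_T-l_T=1$. "Optimal" means minimal pixel expansion among $\mathfrak S$-extended schemes whose images all have positive contrast. -}

module Defs where

open import Data.Bool using (Bool; true; false; _∧_; _∨_; if_then_else_; T)
open import Data.Nat using (ℕ; zero; suc; _+_; _∸_; _^_; _≤_; _<_; _<ᵇ_)
open import Data.Fin using (Fin)
open import Data.Fin.Subset using (Subset; ∣_∣; _⊆_)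
open import Data.Vec using (Vec; []; _∷_; lookup; tabulate; toList; count; allFin)
open import Data.List using (List; []; _∷_; map; filter; _++_)
open import Data.Nat.ListAction using (sum)
open import Data.List.Membership.Propositional using (_∈_)
open import Data.List.Relation.Binary.Permutation.Propositional using (_↭_)
open import Data.Product using (_×_)
open import Relation.Binary.PropositionalEquality using (_≡_; _≢_)
open import Relation.Nullary using (¬_)
open import Relation.Nullary.Decidable using (does)
open import Data.Bool.Properties using (T?)

-- Boolean n × m matrices: n rows (transparencies), each of length m (subpixels).
Matrix : ℕ → ℕ → Set
Matrix n m = Vec (Vec Bool m) n

inSb : ∀ {n} → Subset n → Bool
inSb {n} T = (0 <ᵇ ∣ T ∣) ∧ (∣ T ∣ <ᵇ n)

InS : ∀ {n} → Subset n → Set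
InS T = Data.Bool.T (inSb T)

Family : ℕ → Set
Family n = Subset n → Bool

IsSubFamily : ∀ {n} → Family n → Set
IsSubFamily {n} 𝔗 = ∀ (S : Subset n) → 𝔗 S ≡ true → InS S

orRows : ∀ {n m} → Subset n → Matrix n m → Vec Bool m
orRows {n} {m} S B = tabulate λ j → orAll j (toList (allFin n))
  where
  orAll : Fin m → List (Fin n) → Bool
  orAll j [] = false
  orAll j (i ∷ is) = (lookup S i ∧ lookup (lookup B i) j) ∨ orAll j is

weight : ∀ {m} → Vec Bool m → ℕ
weight v = count (λ b → T? b) v

restrict : ∀ {n m} → Subset n → Matrix n m → List (Vec Bool m)
restrict {n} Q B = go (toList (allFin n))
  where
  go : List (Fin n) → List (Vec Bool _)
  go [] = []
  go (i ∷ is) = if lookup Q i then lookup B i ∷ go is else go is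

AgreeOn : ∀ {n} → Subset n → Family n → Family n → Set
AgreeOn {n} Q 𝔗 𝔗' = ∀ (S : Subset n) → InS S → S ⊆ Q → 𝔗 S ≡ 𝔗' S

-- An 𝔖-extended visual cryptography scheme with n transparencies and pixel
-- expansion m. Multisets of matrices are lists up to permutation (_↭_).
record Scheme (n m : ℕ) : Set where
  field
    l h : Subset n → ℕ
    l≤h : ∀ S → InS S → l S ≤ h S
    h≤m : ∀ S → InS S → h S ≤ m
    C : Family n → List (Matrix n m)
    nonempty : ∀ 𝔗 → IsSubFamily 𝔗 → C 𝔗 ≢ []
    weights : ∀ 𝔗 → IsSubFamily 𝔗 → ∀ B → B ∈ C 𝔗 → ∀ S → InS S →
              weight (orRows S B) ≡ (if 𝔗 S then h S else l S)
    security : ∀ (Q : Subset n) 𝔗 𝔗' → IsSubFamily 𝔗 → IsSubFamily 𝔗' →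
               AgreeOn Q 𝔗 𝔗' →
               map (restrict Q) (C 𝔗) ↭ map (restrict Q) (C 𝔗')

PositiveContrast : ∀ {n m} → Scheme n m → Set
PositiveContrast {n} S = ∀ (U : Subset n) → InS U → Scheme.l S U < Scheme.h S U

allSubsets : (n : ℕ) → List (Subset n)
allSubsets zero = [] ∷ []
allSubsets (suc n) = map (true ∷_) (allSubsets n) ++ map (false ∷_) (allSubsets n)

drosteExpansion : ℕ → ℕ
drosteExpansion n = sum (map (λ S → if inSb S then 2 ^ (∣ S ∣ ∸ 1) else 0) (allSubsets n))

DrosteOptimal : ℕ → Set
DrosteOptimal n = ∀ m (S : Scheme n m) → PositiveContrast S → drosteExpansion n ≤ m

-- Let μ(W,S) = [W ⊆ S]·(-1)^|S ∖ W| be the Möbius function of the Boolean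
-- lattice and A(W,S) = μ(W,S) + μ(∁W,S).  For every W pick a matrix B_W of the scheme realising
-- the family {S ∈ 𝔖 : A(W,S) > 0}.  By Möbius inversion Σ_S A(W,S)·#{columns of B_W missing S}
-- counts the columns of B_W equal to W or to ∁W, so it is nonnegative.  Summing over W first
-- instead, S = ∅ contributes 2m, S = {1..n} contributes nothing as n is odd, and S ∈ 𝔖 contributes
-- -(h_S - l_S)·Σ_W A(W,S)⁺ = -(h_S - l_S)·2^|S| ≤ -2^|S|.  Hence 2m ≥ Σ_{S∈𝔖} 2^|S|, which is
-- twice Droste's pixel expansion.
--
-- In Droste's scheme the block of T ∈ 𝔖 consists of the columns Y ∪ ∁T with
-- Y ⊆ T and |Y| ≡ 𝔗(T) (mod 2).  If 𝔗(T) ≡ |T| for some T, that block contains the all-black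
-- column, which carries no information and can be dropped.  The one remaining family has
-- 𝔗(T) ≢ |T| for all T; its blocks contain the complements of all odd sets, and exchanging these
-- for the complements of the even sets, one of which is all black, is invisible to every proper
-- set of rows.  Using the columns in all orders gives the multisets of matrices.
module Submission where

open import Defs
open import Algebra.Bundles using (CommutativeSemiring)
open import Data.Bool using (Bool; true; false; not; _∧_; _∨_; _xor_; if_then_else_; T)
open import Data.Fin using (Fin; zero; suc)
open import Data.Fin.Subset using (Subset; ⊥; ⊤; ∁; _∩_; _⊆_; Nonempty)
open import Data.Nat using (ℕ; zero; suc)
open import Data.Product using (∃; Σ; _×_; _,_; proj₁; proj₂)
open import Data.Sum using (_⊎_; inj₁; inj₂)
open import Data.Vec using (Vec; []; _∷_; here; there)
open import Function using (_∘_)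
open import Function.Bundles using (Equivalence)
open import Relation.Binary.PropositionalEquality
  using (_≡_; _≢_; refl; cong; cong₂; sym; trans; subst; subst₂; module ≡-Reasoning)
open import Relation.Nullary using (contradiction)
open import Relation.Nullary.Decidable using (does)

-- Subsets of Fin n and the family 𝔖
module _ where

  open import Data.Bool.Properties using (not-distribˡ-xor; not-distribʳ-xor; ∨-zeroʳ; T-∧)
  import Data.Bool.Properties as Bool
  open import Data.Fin.Subset using (_∈_; _∉_; ∣_∣)
  open import Data.Fin.Subset.Properties using (∣p∣≤n; ∣p∣≡n⇒p≡⊤; ∣⊥∣≡0; drop-there)
  open import Data.Nat using (_<ᵇ_)
  open import Data.Nat.Properties using (≤-antisym; ≮⇒≥; <⇒<ᵇ)
  open import Data.Vec using (updateAt)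
  open import Data.Vec.Properties using (≡-dec)
  open import Relation.Binary.Definitions using (DecidableEquality)

  private
    variable
      n : ℕ

  parity : Subset n → Bool
  parity []      = false
  parity (b ∷ S) = b xor parity S

  meets : Subset n → Subset n → Bool
  meets []      []      = false
  meets (s ∷ S) (x ∷ X) = (s ∧ x) ∨ meets S X

  infix 4 _≟_
  _≟_ : DecidableEquality (Subset n)
  _≟_ = ≡-dec Bool._≟_

  parity-⊥ : ∀ n → parity (⊥ {n}) ≡ false
  parity-⊥ zero    = refl
  parity-⊥ (suc n) = parity-⊥ n

  flip : Fin n → Subset n → Subset n
  flip j S = updateAt S j not

  parity-flip : ∀ (j : Fin n) Y → parity (flip j Y) ≡ not (parity Y)
  parity-flip zero    (y ∷ Y) = sym (not-distribˡ-xor y (parity Y))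
  parity-flip (suc j) (y ∷ Y) rewrite parity-flip j Y = sym (not-distribʳ-xor y (parity Y))

  ∁-flip : ∀ (j : Fin n) Y → ∁ (flip j Y) ≡ flip j (∁ Y)
  ∁-flip zero    (y ∷ Y) = refl
  ∁-flip (suc j) (y ∷ Y) = cong (not y ∷_) (∁-flip j Y)

  ∩-flip : ∀ {j : Fin n} {Q} → j ∉ Q → ∀ Y → Q ∩ flip j Y ≡ Q ∩ Y
  ∩-flip {j = zero}  {false ∷ Q} j∉Q (y ∷ Y) = refl
  ∩-flip {j = zero}  {true  ∷ Q} j∉Q (y ∷ Y) = contradiction here j∉Q
  ∩-flip {j = suc j} {q ∷ Q}     j∉Q (y ∷ Y) = cong (q ∧ y ∷_) (∩-flip (j∉Q ∘ there) Y)

  meets-∩ : ∀ (S X : Subset n) → meets S (S ∩ X) ≡ meets S X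
  meets-∩ []          []      = refl
  meets-∩ (true  ∷ S) (x ∷ X) = cong (x ∨_) (meets-∩ S X)
  meets-∩ (false ∷ S) (x ∷ X) = meets-∩ S X

  meets-flip : ∀ {j : Fin n} {S} → j ∉ S → ∀ X → meets S (flip j X) ≡ meets S X
  meets-flip {j = j} {S} j∉S X = begin
    meets S (flip j X)        ≡⟨ meets-∩ S (flip j X) ⟨
    meets S (S ∩ flip j X)    ≡⟨ cong (meets S) (∩-flip j∉S X) ⟩
    meets S (S ∩ X)           ≡⟨ meets-∩ S X ⟩
    meets S X                 ∎
    where open ≡-Reasoning

  meets-⊥ : ∀ (X : Subset n) → meets ⊥ X ≡ false
  meets-⊥ []      = refl
  meets-⊥ (x ∷ X) = meets-⊥ X

  meets-∈ : ∀ {j : Fin n} {S X} → j ∈ S → j ∈ X → meets S X ≡ true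
  meets-∈ here here = refl
  meets-∈ {S = s ∷ _} {x ∷ _} (there j∈S) (there j∈X) rewrite meets-∈ j∈S j∈X = ∨-zeroʳ (s ∧ x)

  ⊆-or-witness : (P Q : Subset n) → P ⊆ Q ⊎ ∃ λ j → j ∈ P × j ∉ Q
  ⊆-or-witness []      []      = inj₁ λ ()
  ⊆-or-witness (p ∷ P) (q ∷ Q) with ⊆-or-witness P Q
  ⊆-or-witness (p ∷ P)     (q ∷ Q)     | inj₂ (j , j∈P , j∉Q) = inj₂ (suc j , there j∈P , j∉Q ∘ drop-there)
  ⊆-or-witness (false ∷ P) (q ∷ Q)     | inj₁ P⊆Q = inj₁ λ { (there j∈P) → there (P⊆Q j∈P) }
  ⊆-or-witness (true  ∷ P) (true  ∷ Q) | inj₁ P⊆Q =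
    inj₁ λ { here → here ; (there j∈P) → there (P⊆Q j∈P) }
  ⊆-or-witness (true  ∷ P) (false ∷ Q) | inj₁ _   = inj₂ (zero , here , λ ())

  InS⇒Nonempty : ∀ (S : Subset n) → InS S → Nonempty S
  InS⇒Nonempty S S∈𝔖 = nonempty S (proj₁ (Equivalence.to T-∧ S∈𝔖))
    where
    nonempty : ∀ {n} (S : Subset n) → T (0 <ᵇ ∣ S ∣) → Nonempty S
    nonempty (true  ∷ S) _ = zero , here
    nonempty (false ∷ S) p with j , j∈S ← nonempty S p = suc j , there j∈S

  InS⇒Nonempty∁ : ∀ (S : Subset n) → InS S → Nonempty (∁ S)
  InS⇒Nonempty∁ S S∈𝔖 = coNonempty S (proj₂ (Equivalence.to T-∧ S∈𝔖))
    where
    coNonempty : ∀ {n} (S : Subset n) → T (∣ S ∣ <ᵇ n) → Nonempty (∁ S)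
    coNonempty (false ∷ S) _ = zero , here
    coNonempty (true  ∷ S) p with j , j∈∁S ← coNonempty S p = suc j , there j∈∁S

  inSb-⊥ : inSb (⊥ {suc n}) ≡ false
  inSb-⊥ {n} rewrite ∣⊥∣≡0 n = refl

  inSb-⊤ : inSb (⊤ {n}) ≡ false
  inSb-⊤ {zero}  = refl
  inSb-⊤ {suc n} = ∣⊤∣<ᵇn n
    where
    ∣⊤∣<ᵇn : ∀ n → (∣ ⊤ {n} ∣ <ᵇ n) ≡ false
    ∣⊤∣<ᵇn zero    = refl
    ∣⊤∣<ᵇn (suc n) = ∣⊤∣<ᵇn n

  ∉𝔖⇒⊥⊎⊤ : ∀ (S : Subset n) → inSb S ≡ false → S ≡ ⊥ ⊎ S ≡ ⊤
  ∉𝔖⇒⊥⊎⊤ {n} S S∉𝔖 with 0 <ᵇ ∣ S ∣ in nonempty | ∣ S ∣ <ᵇ n in proper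
  ... | false | _     = inj₁ (empty S nonempty)
    where
    empty : ∀ {n} (S : Subset n) → (0 <ᵇ ∣ S ∣) ≡ false → S ≡ ⊥
    empty []          _ = refl
    empty (false ∷ S) p = cong (false ∷_) (empty S p)
  ... | true  | false =
    inj₂ (∣p∣≡n⇒p≡⊤ (≤-antisym (∣p∣≤n S) (≮⇒≥ λ ∣S∣<n → subst T proper (<⇒<ᵇ ∣S∣<n))))
  ... | true  | true  with () ← S∉𝔖

module SubsetSum {c ℓ} (R : CommutativeSemiring c ℓ) where

  open CommutativeSemiring R renaming (refl to ≈-refl; sym to ≈-sym; trans to ≈-trans)
  open import Algebra.Properties.CommutativeSemigroup +-commutativeSemigroup using (interchange; xy∙z≈xz∙y)
  open import Data.Vec.Properties using (∷-injectiveʳ)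
  open import Relation.Binary.Reasoning.Setoid setoid

  private
    variable
      n : ℕ

  ∑ : (Subset n → Carrier) → Carrier
  ∑ {zero}  f = f []
  ∑ {suc n} f = ∑ (f ∘ (true ∷_)) + ∑ (f ∘ (false ∷_))

  ∑-syntax : ∀ n → (Subset n → Carrier) → Carrier
  ∑-syntax n = ∑ {n}

  infixl 10 ∑-syntax
  syntax ∑-syntax n (λ S → e) = ∑[ S ⊆ n ] e

  ∑-cong : {f g : Subset n → Carrier} → (∀ S → f S ≈ g S) → ∑ f ≈ ∑ g
  ∑-cong {zero}  f≈g = f≈g []
  ∑-cong {suc n} f≈g = +-cong (∑-cong (f≈g ∘ (true ∷_))) (∑-cong (f≈g ∘ (false ∷_)))

  ∑-zero : ∑ {n} (λ _ → 0#) ≈ 0#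
  ∑-zero {zero}  = ≈-refl
  ∑-zero {suc n} = ≈-trans (+-cong (∑-zero {n}) (∑-zero {n})) (+-identityˡ 0#)

  ∑-distrib-+ : (f g : Subset n → Carrier) → ∑[ S ⊆ n ] (f S + g S) ≈ ∑ f + ∑ g
  ∑-distrib-+ {zero}  f g = ≈-refl
  ∑-distrib-+ {suc n} f g = ≈-trans
    (+-cong (∑-distrib-+ (f ∘ (true ∷_)) (g ∘ (true ∷_))) (∑-distrib-+ (f ∘ (false ∷_)) (g ∘ (false ∷_))))
    (interchange _ _ _ _)

  *-distribˡ-∑ : ∀ x (f : Subset n → Carrier) → x * ∑ f ≈ ∑[ S ⊆ n ] (x * f S)
  *-distribˡ-∑ {zero}  x f = ≈-refl
  *-distribˡ-∑ {suc n} x f = ≈-trans (distribˡ x _ _)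
    (+-cong (*-distribˡ-∑ x (f ∘ (true ∷_))) (*-distribˡ-∑ x (f ∘ (false ∷_))))

  ∑-comm : ∀ {m} (f : Subset m → Subset n → Carrier) →
           ∑[ S ⊆ m ] ∑[ T ⊆ n ] f S T ≈ ∑[ T ⊆ n ] ∑[ S ⊆ m ] f S T
  ∑-comm {m = zero}  f = ≈-refl
  ∑-comm {n} {m = suc m} f = begin
    ∑[ S ⊆ m ] ∑[ T ⊆ n ] f (true ∷ S) T + ∑[ S ⊆ m ] ∑[ T ⊆ n ] f (false ∷ S) T
      ≈⟨ +-cong (∑-comm (f ∘ (true ∷_))) (∑-comm (f ∘ (false ∷_))) ⟩
    ∑[ T ⊆ n ] ∑[ S ⊆ m ] f (true ∷ S) T + ∑[ T ⊆ n ] ∑[ S ⊆ m ] f (false ∷ S) T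
      ≈⟨ ∑-distrib-+ (λ T → ∑[ S ⊆ m ] f (true ∷ S) T) (λ T → ∑[ S ⊆ m ] f (false ∷ S) T) ⟨
    ∑[ T ⊆ n ] (∑[ S ⊆ m ] f (true ∷ S) T + ∑[ S ⊆ m ] f (false ∷ S) T) ∎

  ∑-∁ : (f : Subset n → Carrier) → ∑[ S ⊆ n ] f (∁ S) ≈ ∑ f
  ∑-∁ {zero}  f = ≈-refl
  ∑-∁ {suc n} f = ≈-trans (+-cong (∑-∁ (f ∘ (false ∷_))) (∑-∁ (f ∘ (true ∷_)))) (+-comm _ _)

  ∑-factor : (g : Subset (suc n) → Carrier) (c : Bool → Carrier) (h : Subset n → Carrier) →
             (∀ b S → g (b ∷ S) ≈ c b * h S) → ∑ g ≈ (c true + c false) * ∑ h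
  ∑-factor {n} g c h g≈ch = begin
    ∑ (g ∘ (true ∷_)) + ∑ (g ∘ (false ∷_))
      ≈⟨ +-cong (∑-cong (g≈ch true)) (∑-cong (g≈ch false)) ⟩
    ∑[ S ⊆ n ] (c true * h S) + ∑[ S ⊆ n ] (c false * h S)
      ≈⟨ +-cong (*-distribˡ-∑ _ h) (*-distribˡ-∑ _ h) ⟨
    c true * ∑ h + c false * ∑ h
      ≈⟨ distribʳ _ _ _ ⟨
    (c true + c false) * ∑ h ∎

  ∑-update : (f g : Subset n → Carrier) (S : Subset n) → (∀ T → T ≢ S → f T ≈ g T) →
             ∑ f + g S ≈ ∑ g + f S
  ∑-update {zero}  f g [] _ = +-comm _ _
  ∑-update {suc n} f g (true ∷ S) f≈g = begin
    ∑ (f ∘ (true ∷_)) + ∑ (f ∘ (false ∷_)) + g (true ∷ S)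
      ≈⟨ xy∙z≈xz∙y _ _ _ ⟩
    ∑ (f ∘ (true ∷_)) + g (true ∷ S) + ∑ (f ∘ (false ∷_))
      ≈⟨ +-cong (∑-update (f ∘ (true ∷_)) (g ∘ (true ∷_)) S λ T T≢S → f≈g _ (T≢S ∘ ∷-injectiveʳ))
                (∑-cong λ T → f≈g (false ∷ T) λ ()) ⟩
    ∑ (g ∘ (true ∷_)) + f (true ∷ S) + ∑ (g ∘ (false ∷_))
      ≈⟨ xy∙z≈xz∙y _ _ _ ⟨
    ∑ (g ∘ (true ∷_)) + ∑ (g ∘ (false ∷_)) + f (true ∷ S) ∎
  ∑-update {suc n} f g (false ∷ S) f≈g = begin
    ∑ (f ∘ (true ∷_)) + ∑ (f ∘ (false ∷_)) + g (false ∷ S)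
      ≈⟨ +-assoc _ _ _ ⟩
    ∑ (f ∘ (true ∷_)) + (∑ (f ∘ (false ∷_)) + g (false ∷ S))
      ≈⟨ +-cong (∑-cong λ T → f≈g (true ∷ T) λ ())
                (∑-update (f ∘ (false ∷_)) (g ∘ (false ∷_)) S λ T T≢S → f≈g _ (T≢S ∘ ∷-injectiveʳ)) ⟩
    ∑ (g ∘ (true ∷_)) + (∑ (g ∘ (false ∷_)) + f (false ∷ S))
      ≈⟨ +-assoc _ _ _ ⟨
    ∑ (g ∘ (true ∷_)) + ∑ (g ∘ (false ∷_)) + f (false ∷ S) ∎

  ∑-single : ∀ {n} (f : Subset n → Carrier) (S : Subset n) → (∀ T → T ≢ S → f T ≈ 0#) → ∑ f ≈ f S
  ∑-single {n} f S f≈0 = begin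
    ∑ f                    ≈⟨ +-identityʳ _ ⟨
    ∑ f + 0#               ≈⟨ ∑-update f (λ _ → 0#) S f≈0 ⟩
    ∑ {n} (λ _ → 0#) + f S ≈⟨ +-congʳ (∑-zero {n}) ⟩
    0# + f S               ≈⟨ +-identityˡ _ ⟩
    f S                    ∎

  ∑-split-𝔖 : (f : Subset (suc n) → Carrier) →
              ∑ f ≈ ∑[ S ⊆ suc n ] (if inSb S then f S else 0#) + (f ⊤ + f ⊥)
  ∑-split-𝔖 {n} f = begin
    ∑ f
      ≈⟨ ∑-cong (λ S → split (inSb S) (f S)) ⟩
    ∑[ S ⊆ suc n ] (inside S + outside S)
      ≈⟨ ∑-distrib-+ inside outside ⟩
    ∑ inside + ∑ outside
      ≈⟨ +-congˡ (+-cong (∑-single _ ⊤ vanish-⊤) (∑-single _ ⊥ vanish-⊥)) ⟩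
    ∑ inside + (outside ⊤ + outside ⊥)
      ≡⟨ cong (λ b → ∑ inside + ((if b then 0# else f ⊤) + outside ⊥)) (inSb-⊤ {suc n}) ⟩
    ∑ inside + (f ⊤ + outside ⊥)
      ≡⟨ cong (λ b → ∑ inside + (f ⊤ + (if b then 0# else f ⊥))) (inSb-⊥ {n}) ⟩
    ∑ inside + (f ⊤ + f ⊥) ∎
    where
    inside outside : Subset (suc n) → Carrier
    inside  S = if inSb S then f S else 0#
    outside S = if inSb S then 0# else f S

    split : ∀ b x → x ≈ (if b then x else 0#) + (if b then 0# else x)
    split true  x = ≈-sym (+-identityʳ x)
    split false x = ≈-sym (+-identityˡ x)

    vanish-⊤ : ∀ T → T ≢ ⊤ → outside (true ∷ T) ≈ 0#
    vanish-⊤ T T≢⊤ with inSb (true ∷ T) in ∈𝔖?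
    ... | true  = ≈-refl
    ... | false with ∉𝔖⇒⊥⊎⊤ (true ∷ T) ∈𝔖?
    ...   | inj₂ eq = contradiction (∷-injectiveʳ eq) T≢⊤

    vanish-⊥ : ∀ T → T ≢ ⊥ → outside (false ∷ T) ≈ 0#
    vanish-⊥ T T≢⊥ with inSb (false ∷ T) in ∈𝔖?
    ... | true  = ≈-refl
    ... | false with ∉𝔖⇒⊥⊎⊤ (false ∷ T) ∈𝔖?
    ...   | inj₁ eq = contradiction (∷-injectiveʳ eq) T≢⊥

-- Droste's pixel expansion in closed form
module _ where

  open import Data.Bool.Properties using (T-≡; T-∧)
  open import Data.Fin.Subset using (∣_∣)
  open import Data.Fin.Subset.Properties using (∣⊥∣≡0; ∣⊤∣≡n)
  open import Data.List using (map; _++_)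
  open import Data.List.Properties using (map-++; map-∘)
  open import Data.Nat using (_+_; _*_; _∸_; _^_; _<ᵇ_)
  open import Data.Nat.ListAction using (sum)
  open import Data.Nat.ListAction.Properties using (sum-++)
  open import Data.Nat.Properties using (+-*-commutativeSemiring; +-identityʳ; *-identityˡ; +-assoc; m+n∸n≡m)

  open SubsetSum +-*-commutativeSemiring
  open ≡-Reasoning

  sum-allSubsets : ∀ n (f : Subset n → ℕ) → sum (map f (allSubsets n)) ≡ ∑ f
  sum-allSubsets zero    f = +-identityʳ (f [])
  sum-allSubsets (suc n) f = begin
    sum (map f (map (true ∷_) subsets ++ map (false ∷_) subsets))
      ≡⟨ cong sum (map-++ f (map (true ∷_) subsets) _) ⟩
    sum (map f (map (true ∷_) subsets) ++ map f (map (false ∷_) subsets))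
      ≡⟨ sum-++ (map f (map (true ∷_) subsets)) _ ⟩
    sum (map f (map (true ∷_) subsets)) + sum (map f (map (false ∷_) subsets))
      ≡⟨ cong₂ (λ xs ys → sum xs + sum ys) (map-∘ subsets) (map-∘ subsets) ⟨
    sum (map (f ∘ (true ∷_)) subsets) + sum (map (f ∘ (false ∷_)) subsets)
      ≡⟨ cong₂ _+_ (sum-allSubsets n (f ∘ (true ∷_))) (sum-allSubsets n (f ∘ (false ∷_))) ⟩
    ∑ (f ∘ (true ∷_)) + ∑ (f ∘ (false ∷_)) ∎
    where subsets = allSubsets n

  ∑-2^∣S∣ : ∀ n → ∑[ S ⊆ n ] (2 ^ ∣ S ∣) ≡ 3 ^ n
  ∑-2^∣S∣ zero    = refl
  ∑-2^∣S∣ (suc n) = begin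
    ∑[ S ⊆ suc n ] (2 ^ ∣ S ∣)  ≡⟨ ∑-factor (λ S → 2 ^ ∣ S ∣) 2or1 (λ S → 2 ^ ∣ S ∣) factor ⟩
    3 * ∑[ S ⊆ n ] (2 ^ ∣ S ∣)  ≡⟨ cong (3 *_) (∑-2^∣S∣ n) ⟩
    3 ^ suc n                   ∎
    where
    2or1 : Bool → ℕ
    2or1 b = if b then 2 else 1
    factor : ∀ b (S : Subset n) → 2 ^ ∣ b ∷ S ∣ ≡ 2or1 b * 2 ^ ∣ S ∣
    factor true  S = refl
    factor false S = sym (*-identityˡ _)

  2*drosteExpansion : ∀ n → 2 * drosteExpansion n ≡ ∑[ S ⊆ n ] (if inSb S then 2 ^ ∣ S ∣ else 0)
  2*drosteExpansion n = begin
    2 * sum (map half (allSubsets n))             ≡⟨ cong (2 *_) (sum-allSubsets n half) ⟩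
    2 * ∑ half                                    ≡⟨ *-distribˡ-∑ 2 half ⟩
    ∑[ S ⊆ n ] (2 * half S)                       ≡⟨ ∑-cong double ⟩
    ∑[ S ⊆ n ] (if inSb S then 2 ^ ∣ S ∣ else 0)  ∎
    where
    half : Subset n → ℕ
    half S = if inSb S then 2 ^ (∣ S ∣ ∸ 1) else 0
    2*2^[k∸1] : ∀ k → T (0 <ᵇ k) → 2 * 2 ^ (k ∸ 1) ≡ 2 ^ k
    2*2^[k∸1] (suc k) _ = refl
    double : ∀ S → 2 * half S ≡ (if inSb S then 2 ^ ∣ S ∣ else 0)
    double S with inSb S in S∈𝔖
    ... | true  = 2*2^[k∸1] ∣ S ∣ (proj₁ (Equivalence.to T-∧ (Equivalence.from T-≡ S∈𝔖)))
    ... | false = refl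

  drosteExpansion-closedForm : ∀ n → 2 * drosteExpansion (suc n) + 2 ^ suc n ≡ 3 ^ suc n ∸ 1
  drosteExpansion-closedForm n = trans (sym (m+n∸n≡m _ 1)) (cong (_∸ 1) (begin
    2 * drosteExpansion (suc n) + 2 ^ suc n + 1
      ≡⟨ +-assoc (2 * drosteExpansion (suc n)) (2 ^ suc n) 1 ⟩
    2 * drosteExpansion (suc n) + (2 ^ suc n + 2 ^ 0)
      ≡⟨ cong₂ (λ x k → x + (2 ^ k + 2 ^ 0)) (2*drosteExpansion (suc n)) (sym (∣⊤∣≡n (suc n))) ⟩
    proper + (2 ^ ∣ ⊤ {suc n} ∣ + 2 ^ 0)
      ≡⟨ cong (λ k → proper + (2 ^ ∣ ⊤ {suc n} ∣ + 2 ^ k)) (∣⊥∣≡0 (suc n)) ⟨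
    proper + (2 ^ ∣ ⊤ {suc n} ∣ + 2 ^ ∣ ⊥ {suc n} ∣)
      ≡⟨ ∑-split-𝔖 {n} (λ S → 2 ^ ∣ S ∣) ⟨
    ∑[ S ⊆ suc n ] (2 ^ ∣ S ∣)
      ≡⟨ ∑-2^∣S∣ (suc n) ⟩
    3 ^ suc n ∎))
    where
    proper : ℕ
    proper = ∑[ S ⊆ suc n ] (if inSb S then 2 ^ ∣ S ∣ else 0)

-- Matrices as vectors of columns
module _ where

  open import Data.List as List using (List; foldr)
  open import Data.List.Properties using (foldr-universal; foldr-cong; foldr-map)
  open import Data.Vec as Vec using (lookup; tabulate; toList; allFin; countᵇ)
  open import Data.Vec.Properties
    using ( lookup∘tabulate; tabulate∘lookup; tabulate-∘; tabulate-cong; toList-map; lookup-map; lookup-zipWith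
          ; map-∘; map-cong)
  open import Function using (id)

  private
    variable
      n m : ℕ

  column : Matrix n m → Fin m → Subset n
  column B j = Vec.map (λ row → lookup row j) B

  columns : Matrix n m → Vec (Subset n) m
  columns B = tabulate (column B)

  fromColumns : Vec (Subset n) m → Matrix n m
  fromColumns cs = tabulate λ i → Vec.map (λ X → lookup X i) cs

  columns-fromColumns : (cs : Vec (Subset n) m) → columns (fromColumns cs) ≡ cs
  columns-fromColumns cs = begin
    tabulate (λ j → Vec.map (λ row → lookup row j) (tabulate λ i → Vec.map (λ X → lookup X i) cs))
      ≡⟨ tabulate-cong (λ j → tabulate-∘ (λ row → lookup row j) _) ⟨
    tabulate (λ j → tabulate λ i → lookup (Vec.map (λ X → lookup X i) cs) j)
      ≡⟨ tabulate-cong (λ j → tabulate-cong λ i → lookup-map j (λ X → lookup X i) cs) ⟩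
    tabulate (λ j → tabulate λ i → lookup (lookup cs j) i)
      ≡⟨ tabulate-cong (λ j → tabulate∘lookup (lookup cs j)) ⟩
    tabulate (lookup cs)
      ≡⟨ tabulate∘lookup cs ⟩
    cs ∎
    where open ≡-Reasoning

  foldr-allFin-suc : ∀ {B : Set} (F : Fin (suc n) → B → B) e →
                     foldr F e (toList (allFin (suc n))) ≡ F zero (foldr (F ∘ suc) e (toList (allFin n)))
  foldr-allFin-suc {n} F e = cong (F zero) (trans
    (cong (foldr F e) (trans (cong toList (tabulate-∘ suc id)) (toList-map suc (allFin n))))
    (foldr-map F suc e (toList (allFin n))))

  meets-foldr : ∀ (S X : Subset n) →
                foldr (λ i b → (lookup S i ∧ lookup X i) ∨ b) false (toList (allFin n)) ≡ meets S X
  meets-foldr []      []      = refl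
  meets-foldr (s ∷ S) (x ∷ X) =
    trans (foldr-allFin-suc (λ i b → (lookup (s ∷ S) i ∧ lookup (x ∷ X) i) ∨ b) false)
          (cong ((s ∧ x) ∨_) (meets-foldr S X))

  orRows-columns : ∀ (S : Subset n) (B : Matrix n m) → orRows S B ≡ Vec.map (meets S) (columns B)
  orRows-columns {n} S B = trans (sym (tabulate∘lookup (orRows S B)))
    (trans (tabulate-cong orRow) (tabulate-∘ (meets S) (column B)))
    where
    anyRow : Fin _ → Fin n → Bool → Bool
    anyRow j i b = (lookup S i ∧ lookup (lookup B i) j) ∨ b
    -- orRows folds over the row indices with a local function of Defs that cannot be named;
    -- foldr-universal identifies it with an explicit fold, once the index list is abstracted.
    asFoldr : ∀ j → lookup (orRows S B) j ≡ foldr (anyRow j) false (toList (allFin n))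
    asFoldr j with foldr-universal _ (anyRow j) false refl (λ _ _ → refl)
    ... | eq with toList (allFin n)
    ... | is = trans (lookup∘tabulate _ j) (eq is)
    orRow : ∀ j → lookup (orRows S B) j ≡ meets S (column B j)
    orRow j = trans (asFoldr j) (trans (foldr-cong entry refl (toList (allFin n))) (meets-foldr S (column B j)))
      where
      entry : ∀ i b → anyRow j i b ≡ (lookup S i ∧ lookup (column B j) i) ∨ b
      entry i b = cong (λ x → (lookup S i ∧ x) ∨ b) (sym (lookup-map i (λ row → lookup row j) B))

  weight-map : ∀ (p : Subset n → Bool) (cs : Vec (Subset n) m) → weight (Vec.map p cs) ≡ countᵇ p cs
  weight-map p []       = refl
  weight-map p (c ∷ cs) with p c
  ... | true  = cong suc (weight-map p cs)
  ... | false = weight-map p cs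

  weight-orRows : ∀ (S : Subset n) (B : Matrix n m) → weight (orRows S B) ≡ countᵇ (meets S) (columns B)
  weight-orRows S B = trans (cong weight (orRows-columns S B)) (weight-map (meets S) (columns B))

  restrict-fromColumns-∩ : ∀ (Q : Subset n) (cs : Vec (Subset n) m) →
                           restrict Q (fromColumns cs) ≡ restrict Q (fromColumns (Vec.map (Q ∩_) cs))
  restrict-fromColumns-∩ {n} Q cs = trans (asFoldr (fromColumns cs))
    (trans (foldr-cong sameRow refl (toList (allFin n)))
           (sym (asFoldr (fromColumns (Vec.map (Q ∩_) cs)))))
    where
    keep : ∀ {m} → Matrix n m → Fin n → List (Vec Bool m) → List (Vec Bool m)
    keep B i rs = if lookup Q i then lookup B i List.∷ rs else rs
    asFoldr : (B : Matrix n m) → restrict Q B ≡ foldr (keep B) List.[] (toList (allFin n))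
    asFoldr B with foldr-universal _ (keep B) List.[] refl (λ _ _ → refl)
    ... | eq with toList (allFin n)
    ... | is = eq is
    sameRow : ∀ i rs → keep (fromColumns cs) i rs ≡ keep (fromColumns (Vec.map (Q ∩_) cs)) i rs
    sameRow i rs with lookup Q i in i∈Q
    ... | false = refl
    ... | true  = cong (List._∷ rs) (begin
      lookup (fromColumns cs) i                       ≡⟨ lookup∘tabulate _ i ⟩
      Vec.map (λ X → lookup X i) cs                   ≡⟨ map-cong (λ X → cong (_∧ lookup X i) i∈Q) cs ⟨
      Vec.map (λ X → lookup Q i ∧ lookup X i) cs      ≡⟨ map-cong (λ X → lookup-zipWith _∧_ i Q X) cs ⟨
      Vec.map (λ X → lookup (Q ∩ X) i) cs             ≡⟨ map-∘ (λ X → lookup X i) (Q ∩_) cs ⟩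
      Vec.map (λ X → lookup X i) (Vec.map (Q ∩_) cs)  ≡⟨ lookup∘tabulate _ i ⟨
      lookup (fromColumns (Vec.map (Q ∩_) cs)) i      ∎)
      where open ≡-Reasoning

-- The Möbius function of the Boolean lattice
module _ where

  open import Data.Fin.Subset as Subset using (_∈_)
  open import Data.Fin.Subset.Properties using (∉⊥)
  open import Data.Integer using (ℤ; +_; +[1+_]; -[1+_]; +≤+; 0ℤ; 1ℤ; -1ℤ; _+_; _*_; -_; _≤_; _≤ᵇ_; ∣_∣)
  import Data.Integer.Properties as ℤ
  open import Algebra.Properties.CommutativeSemigroup ℤ.*-commutativeSemigroup using (interchange)
  import Data.Bool.Properties as Bool
  import Data.Nat as ℕ
  open import Data.Nat using (z≤n)
  open import Relation.Nullary.Decidable using (dec-false)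

  open SubsetSum ℤ.+-*-commutativeSemiring
  open ≡-Reasoning

  private
    variable
      n : ℕ

  𝟙 : Bool → ℤ
  𝟙 true  = 1ℤ
  𝟙 false = 0ℤ

  𝟙-∧ : ∀ a b → 𝟙 (a ∧ b) ≡ 𝟙 a * 𝟙 b
  𝟙-∧ true  b = sym (ℤ.*-identityˡ (𝟙 b))
  𝟙-∧ false b = refl

  0≤𝟙 : ∀ b → 0ℤ ≤ 𝟙 b
  0≤𝟙 true  = +≤+ z≤n
  0≤𝟙 false = +≤+ z≤n

  -- möbius W S is μ(W,S) = [W ⊆ S]·(-1)^|S ∖ W| of the header, built one coordinate at a time.
  möbius₁ : Bool → Bool → ℤ
  möbius₁ false false = 1ℤ
  möbius₁ false true  = -1ℤ
  möbius₁ true  false = 0ℤ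
  möbius₁ true  true  = 1ℤ

  möbius : Subset n → Subset n → ℤ
  möbius []      []      = 1ℤ
  möbius (w ∷ W) (s ∷ S) = möbius₁ w s * möbius W S

  ∑-möbius-disjoint : ∀ (W X : Subset n) →
                      ∑[ S ⊆ n ] (möbius W S * 𝟙 (not (meets S X))) ≡ 𝟙 (does (∁ W ≟ X))
  ∑-möbius-disjoint []      []      = refl
  ∑-möbius-disjoint {suc n} (w ∷ W) (x ∷ X) = begin
    ∑[ S ⊆ suc n ] (möbius (w ∷ W) S * 𝟙 (not (meets S (x ∷ X))))
      ≡⟨ ∑-factor (λ S → möbius (w ∷ W) S * 𝟙 (not (meets S (x ∷ X)))) local
                  (λ S → möbius W S * 𝟙 (not (meets S X))) factor ⟩
    (local true + local false) * ∑[ S ⊆ n ] (möbius W S * 𝟙 (not (meets S X)))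
      ≡⟨ cong₂ _*_ (table w x) (∑-möbius-disjoint W X) ⟩
    𝟙 (does (not w Bool.≟ x)) * 𝟙 (does (∁ W ≟ X))
      ≡⟨ 𝟙-∧ (does (not w Bool.≟ x)) _ ⟨
    𝟙 (does (∁ (w ∷ W) ≟ x ∷ X)) ∎
    where
    coordinate : Bool → Bool → Bool → ℤ
    coordinate w x s = möbius₁ w s * 𝟙 (not (s ∧ x))
    local : Bool → ℤ
    local = coordinate w x
    𝟙-not-∨ : ∀ a b → 𝟙 (not (a ∨ b)) ≡ 𝟙 (not a) * 𝟙 (not b)
    𝟙-not-∨ true  b = refl
    𝟙-not-∨ false b = sym (ℤ.*-identityˡ _)
    factor : ∀ s S → möbius (w ∷ W) (s ∷ S) * 𝟙 (not (meets (s ∷ S) (x ∷ X)))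
                     ≡ local s * (möbius W S * 𝟙 (not (meets S X)))
    factor s S = trans (cong (möbius₁ w s * möbius W S *_) (𝟙-not-∨ (s ∧ x) (meets S X)))
                       (interchange (möbius₁ w s) (möbius W S) (𝟙 (not (s ∧ x))) (𝟙 (not (meets S X))))
    table : ∀ w x → coordinate w x true + coordinate w x false ≡ 𝟙 (does (not w Bool.≟ x))
    table false false = refl
    table false true  = refl
    table true  false = refl
    table true  true  = refl

  2*i≡i+i : ∀ i → + 2 * i ≡ i + i
  2*i≡i+i i = trans (ℤ.*-distribʳ-+ i 1ℤ 1ℤ) (cong₂ _+_ (ℤ.*-identityˡ i) (ℤ.*-identityˡ i))

  ∑-möbius : ∀ (S : Subset n) → ∑[ W ⊆ n ] möbius W S ≡ 𝟙 (does (S ≟ ⊥))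
  ∑-möbius []                = refl
  ∑-möbius {suc n} (s ∷ S) = begin
    ∑[ W ⊆ suc n ] möbius W (s ∷ S)
      ≡⟨ ∑-factor (λ W → möbius W (s ∷ S)) (λ w → möbius₁ w s) (λ W → möbius W S) (λ _ _ → refl) ⟩
    (möbius₁ true s + möbius₁ false s) * ∑[ W ⊆ n ] möbius W S
      ≡⟨ cong₂ _*_ (table s) (∑-möbius S) ⟩
    𝟙 (does (s Bool.≟ false)) * 𝟙 (does (S ≟ ⊥))
      ≡⟨ 𝟙-∧ (does (s Bool.≟ false)) _ ⟨
    𝟙 (does (s ∷ S ≟ ⊥)) ∎
    where
    table : ∀ s → möbius₁ true s + möbius₁ false s ≡ 𝟙 (does (s Bool.≟ false))
    table false = refl
    table true  = refl

  ∑-∣möbius∣ : ∀ (S : Subset n) → ∑[ W ⊆ n ] (+ ∣ möbius W S ∣) ≡ + (2 ℕ.^ Subset.∣ S ∣)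
  ∑-∣möbius∣ []                = refl
  ∑-∣möbius∣ {suc n} (s ∷ S) = begin
    ∑[ W ⊆ suc n ] (+ ∣ möbius W (s ∷ S) ∣)
      ≡⟨ ∑-factor (λ W → + ∣ möbius W (s ∷ S) ∣) local (λ W → + ∣ möbius W S ∣) factor ⟩
    (local true + local false) * ∑[ W ⊆ n ] (+ ∣ möbius W S ∣)
      ≡⟨ cong ((local true + local false) *_) (∑-∣möbius∣ S) ⟩
    (local true + local false) * + (2 ℕ.^ Subset.∣ S ∣)
      ≡⟨ table s ⟩
    + (2 ℕ.^ Subset.∣ s ∷ S ∣) ∎
    where
    local : Bool → ℤ
    local w = + ∣ möbius₁ w s ∣
    factor : ∀ w W → + ∣ möbius₁ w s * möbius W S ∣ ≡ local w * + ∣ möbius W S ∣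
    factor w W = trans (cong +_ (ℤ.abs-* (möbius₁ w s) (möbius W S)))
                       (ℤ.pos-* ∣ möbius₁ w s ∣ ∣ möbius W S ∣)
    table : ∀ s → (+ ∣ möbius₁ true s ∣ + + ∣ möbius₁ false s ∣) * + (2 ℕ.^ Subset.∣ S ∣)
                  ≡ + (2 ℕ.^ Subset.∣ s ∷ S ∣)
    table false = ℤ.*-identityˡ _
    table true  = sym (ℤ.pos-* 2 (2 ℕ.^ Subset.∣ S ∣))

  möbius-∁-⊤ : ∀ (W : Subset n) →
               möbius (∁ W) ⊤ ≡ (if parity (⊤ {n}) then - möbius W ⊤ else möbius W ⊤)
  möbius-∁-⊤ []                = refl
  möbius-∁-⊤ {suc n} (w ∷ W) rewrite möbius-∁-⊤ W with parity (⊤ {n}) | w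
  ... | true  | true  = trans (ℤ.-1*i≡-i (- möbius W ⊤)) (trans (ℤ.neg-involutive _) (sym (ℤ.*-identityˡ _)))
  ... | true  | false = trans (ℤ.*-identityˡ (- möbius W ⊤)) (sym (ℤ.-1*i≡-i _))
  ... | false | true  = trans (ℤ.-1*i≡-i (möbius W ⊤)) (cong -_ (sym (ℤ.*-identityˡ _)))
  ... | false | false = trans (ℤ.*-identityˡ (möbius W ⊤))
                              (trans (sym (ℤ.neg-involutive _)) (cong -_ (sym (ℤ.-1*i≡-i _))))

  möbius-∁-product : ∀ {S : Subset n} → Nonempty (∁ S) → ∀ W → möbius W S * möbius (∁ W) S ≡ 0ℤ
  möbius-∁-product {S = false ∷ S} (_ , here) (true  ∷ W) = refl
  möbius-∁-product {S = false ∷ S} (_ , here) (false ∷ W) = ℤ.*-zeroʳ (1ℤ * möbius W S)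
  möbius-∁-product {S = s ∷ S} (suc j , there j∈∁S) (w ∷ W) = begin
    möbius₁ w s * möbius W S * (möbius₁ (not w) s * möbius (∁ W) S)
      ≡⟨ interchange (möbius₁ w s) (möbius W S) (möbius₁ (not w) s) (möbius (∁ W) S) ⟩
    möbius₁ w s * möbius₁ (not w) s * (möbius W S * möbius (∁ W) S)
      ≡⟨ cong (möbius₁ w s * möbius₁ (not w) s *_) (möbius-∁-product (j , j∈∁S) W) ⟩
    möbius₁ w s * möbius₁ (not w) s * 0ℤ
      ≡⟨ ℤ.*-zeroʳ (möbius₁ w s * möbius₁ (not w) s) ⟩
    0ℤ ∎

  symMöbius : Subset n → Subset n → ℤ
  symMöbius W S = möbius W S + möbius (∁ W) S

  symMöbius-⊤ : parity (⊤ {n}) ≡ true → ∀ (W : Subset n) → symMöbius W ⊤ ≡ 0ℤ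
  symMöbius-⊤ {n} odd W rewrite möbius-∁-⊤ W | odd = ℤ.+-inverseʳ (möbius W ⊤)

  ∑-symMöbius : ∀ (S : Subset n) → ∑[ W ⊆ n ] symMöbius W S ≡ 𝟙 (does (S ≟ ⊥)) + 𝟙 (does (S ≟ ⊥))
  ∑-symMöbius S = trans (∑-distrib-+ (λ W → möbius W S) (λ W → möbius (∁ W) S))
    (cong₂ _+_ (∑-möbius S) (trans (∑-∁ (λ W → möbius W S)) (∑-möbius S)))

  ∑-symMöbius-𝔖 : ∀ (S : Subset n) → InS S → ∑[ W ⊆ n ] symMöbius W S ≡ 0ℤ
  ∑-symMöbius-𝔖 S S∈𝔖 with j , j∈S ← InS⇒Nonempty S S∈𝔖 =
    trans (∑-symMöbius S)
          (cong (λ b → 𝟙 b + 𝟙 b) (dec-false (S ≟ ⊥) λ S≡⊥ → ∉⊥ (subst (j ∈_) S≡⊥ j∈S)))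

  ∑-symMöbius-disjoint : ∀ (W X : Subset n) → 0ℤ ≤ ∑[ S ⊆ n ] (symMöbius W S * 𝟙 (not (meets S X)))
  ∑-symMöbius-disjoint {n} W X = ℤ.≤-trans
    (ℤ.+-mono-≤ (0≤𝟙 (does (∁ W ≟ X))) (0≤𝟙 (does (∁ (∁ W) ≟ X))))
    (ℤ.≤-reflexive (begin
      𝟙 (does (∁ W ≟ X)) + 𝟙 (does (∁ (∁ W) ≟ X))
        ≡⟨ cong₂ _+_ (∑-möbius-disjoint W X) (∑-möbius-disjoint (∁ W) X) ⟨
      ∑[ S ⊆ n ] (möbius W S * blank S) + ∑[ S ⊆ n ] (möbius (∁ W) S * blank S)
        ≡⟨ ∑-distrib-+ (λ S → möbius W S * blank S) (λ S → möbius (∁ W) S * blank S) ⟨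
      ∑[ S ⊆ n ] (möbius W S * blank S + möbius (∁ W) S * blank S)
        ≡⟨ ∑-cong (λ S → ℤ.*-distribʳ-+ (blank S) (möbius W S) (möbius (∁ W) S)) ⟨
      ∑[ S ⊆ n ] (symMöbius W S * blank S) ∎))
    where
    blank : Subset n → ℤ
    blank S = 𝟙 (not (meets S X))

  ∣symMöbius∣ : ∀ {S : Subset n} → Nonempty (∁ S) → ∀ W →
                + ∣ symMöbius W S ∣ ≡ + ∣ möbius W S ∣ + + ∣ möbius (∁ W) S ∣
  ∣symMöbius∣ {S = S} S≢⊤ W with ℤ.i*j≡0⇒i≡0∨j≡0 (möbius W S) (möbius-∁-product S≢⊤ W)
  ... | inj₁ μ≡0 rewrite μ≡0 | ℤ.+-identityˡ (möbius (∁ W) S) = refl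
  ... | inj₂ μ∁≡0 rewrite μ∁≡0 | ℤ.+-identityʳ (möbius W S) = sym (ℤ.+-identityʳ _)

  2*positivePart : ∀ i → + 2 * (i * 𝟙 (1ℤ ≤ᵇ i)) ≡ i + + ∣ i ∣
  2*positivePart (+ 0)       = refl
  2*positivePart +[1+ k ]    = trans (cong (+ 2 *_) (ℤ.*-identityʳ +[1+ k ])) (2*i≡i+i +[1+ k ])
  2*positivePart -[1+ k ]    = trans (cong (+ 2 *_) (ℤ.*-zeroʳ -[1+ k ])) (sym (ℤ.+-inverseˡ +[1+ k ]))

  ∑-positivePart : ∀ (S : Subset n) → InS S →
                   ∑[ W ⊆ n ] (symMöbius W S * 𝟙 (1ℤ ≤ᵇ symMöbius W S)) ≡ + (2 ℕ.^ Subset.∣ S ∣)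
  -- 2·a⁺ = a + |a|, and for S ≠ {1..n} at most one of μ(W,S), μ(∁W,S) is nonzero.
  ∑-positivePart {n} S S∈𝔖 = ℤ.*-cancelˡ-≡ (+ 2) _ _ (begin
    + 2 * ∑[ W ⊆ n ] (A W * 𝟙 (1ℤ ≤ᵇ A W))
      ≡⟨ *-distribˡ-∑ (+ 2) (λ W → A W * 𝟙 (1ℤ ≤ᵇ A W)) ⟩
    ∑[ W ⊆ n ] (+ 2 * (A W * 𝟙 (1ℤ ≤ᵇ A W)))
      ≡⟨ ∑-cong (λ W → 2*positivePart (A W)) ⟩
    ∑[ W ⊆ n ] (A W + + ∣ A W ∣)
      ≡⟨ ∑-distrib-+ A (λ W → + ∣ A W ∣) ⟩
    ∑[ W ⊆ n ] A W + ∑[ W ⊆ n ] (+ ∣ A W ∣)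
      ≡⟨ cong₂ _+_ (∑-symMöbius-𝔖 S S∈𝔖) (∑-cong {n} (∣symMöbius∣ {S = S} (InS⇒Nonempty∁ S S∈𝔖))) ⟩
    0ℤ + ∑[ W ⊆ n ] (+ ∣ möbius W S ∣ + + ∣ möbius (∁ W) S ∣)
      ≡⟨ ℤ.+-identityˡ _ ⟩
    ∑[ W ⊆ n ] (+ ∣ möbius W S ∣ + + ∣ möbius (∁ W) S ∣)
      ≡⟨ ∑-distrib-+ (λ W → + ∣ möbius W S ∣) (λ W → + ∣ möbius (∁ W) S ∣) ⟩
    ∑[ W ⊆ n ] (+ ∣ möbius W S ∣) + ∑[ W ⊆ n ] (+ ∣ möbius (∁ W) S ∣)
      ≡⟨ cong (_+_ (∑[ W ⊆ n ] (+ ∣ möbius W S ∣))) (∑-∁ (λ W → + ∣ möbius W S ∣)) ⟩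
    ∑[ W ⊆ n ] (+ ∣ möbius W S ∣) + ∑[ W ⊆ n ] (+ ∣ möbius W S ∣)
      ≡⟨ cong (λ x → x + x) (∑-∣möbius∣ S) ⟩
    + (2 ℕ.^ Subset.∣ S ∣) + + (2 ℕ.^ Subset.∣ S ∣)
      ≡⟨ 2*i≡i+i (+ (2 ℕ.^ Subset.∣ S ∣)) ⟨
    + 2 * + (2 ℕ.^ Subset.∣ S ∣) ∎)
    where
    A : Subset n → ℤ
    A W = symMöbius W S

-- Lower bound for odd n
module _ where

  open import Data.Bool.Properties using (T-≡; T-∧)
  open import Data.Fin.Subset as Subset using ()
  open import Data.Integer using (ℤ; +_; +≤+; 0ℤ; 1ℤ; -1ℤ; _+_; _*_; -_; _-_; _≤_; _≤ᵇ_)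
  import Data.Integer.Properties as ℤ
  open import Data.Integer.Tactic.RingSolver using (solve-∀)
  open import Data.List using ([]; _∷_)
  open import Data.List.Membership.Propositional using (_∈_)
  open import Data.List.Relation.Unary.Any using (here)
  import Data.Nat as ℕ
  import Data.Nat.Properties as ℕ
  open import Data.Vec using (countᵇ)
  open import Relation.Nullary.Decidable using (dec-true)

  open SubsetSum ℤ.+-*-commutativeSemiring
  private
    module ℕΣ = SubsetSum ℕ.+-*-commutativeSemiring
    variable
      n : ℕ

  ∑-mono-≤ : {f g : Subset n → ℤ} → (∀ S → f S ≤ g S) → ∑ f ≤ ∑ g
  ∑-mono-≤ {zero}  f≤g = f≤g []
  ∑-mono-≤ {suc n} f≤g = ℤ.+-mono-≤ (∑-mono-≤ (f≤g ∘ (true ∷_))) (∑-mono-≤ (f≤g ∘ (false ∷_)))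

  ∑-neg : (f : Subset n → ℤ) → ∑[ S ⊆ n ] (- f S) ≡ - ∑ f
  ∑-neg {n} f = begin
    ∑[ S ⊆ n ] (- f S)      ≡⟨ ∑-cong (λ S → ℤ.-1*i≡-i (f S)) ⟨
    ∑[ S ⊆ n ] (-1ℤ * f S)  ≡⟨ *-distribˡ-∑ -1ℤ f ⟨
    -1ℤ * ∑ f               ≡⟨ ℤ.-1*i≡-i (∑ f) ⟩
    - ∑ f                   ∎
    where open ≡-Reasoning

  +-∑ : (f : Subset n → ℕ) → + ℕΣ.∑ f ≡ ∑[ S ⊆ n ] (+ f S)
  +-∑ {zero}  f = refl
  +-∑ {suc n} f = trans (ℤ.pos-+ (ℕΣ.∑ (f ∘ (true ∷_))) _)
                        (cong₂ _+_ (+-∑ (f ∘ (true ∷_))) (+-∑ (f ∘ (false ∷_))))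

  ∑-blanks-nonneg : (c : Subset n → ℤ) → (∀ X → 0ℤ ≤ ∑[ S ⊆ n ] (c S * 𝟙 (not (meets S X)))) →
                    ∀ {m} (cs : Vec (Subset n) m) → 0ℤ ≤ ∑[ S ⊆ n ] (c S * (+ m - + countᵇ (meets S) cs))
  ∑-blanks-nonneg {n} c disjoint-nonneg []       =
    ℤ.≤-reflexive (sym (trans (∑-cong (λ S → ℤ.*-zeroʳ (c S))) (∑-zero {n})))
  ∑-blanks-nonneg {n} c disjoint-nonneg {suc m} (X ∷ cs) = subst (0ℤ ≤_) (sym split)
    (ℤ.+-mono-≤ (disjoint-nonneg X) (∑-blanks-nonneg c disjoint-nonneg cs))
    where
    blanks-∷ : ∀ S → + suc m - + countᵇ (meets S) (X ∷ cs)
                     ≡ 𝟙 (not (meets S X)) + (+ m - + countᵇ (meets S) cs)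
    blanks-∷ S with meets S X
    ... | true  = trans (ℤ.m-n≡m⊖n (suc m) (suc k))
      (trans (ℤ.[1+m]⊖[1+n]≡m⊖n m k) (sym (trans (ℤ.+-identityˡ _) (ℤ.m-n≡m⊖n m k))))
      where k = countᵇ (meets S) cs
    ... | false = ℤ.+-assoc 1ℤ (+ m) (- + countᵇ (meets S) cs)
    split : ∑[ S ⊆ n ] (c S * (+ suc m - + countᵇ (meets S) (X ∷ cs)))
            ≡ ∑[ S ⊆ n ] (c S * 𝟙 (not (meets S X))) + ∑[ S ⊆ n ] (c S * (+ m - + countᵇ (meets S) cs))
    split = trans (∑-cong (λ S → trans (cong (c S *_) (blanks-∷ S)) (ℤ.*-distribˡ-+ (c S) _ _)))
                  (∑-distrib-+ (λ S → c S * 𝟙 (not (meets S X))) (λ S → c S * (+ m - + countᵇ (meets S) cs)))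

  countᵇ-meets-⊥ : ∀ {m} (cs : Vec (Subset n) m) → countᵇ (meets ⊥) cs ≡ 0
  countᵇ-meets-⊥ []       = refl
  countᵇ-meets-⊥ (X ∷ cs) rewrite meets-⊥ X = countᵇ-meets-⊥ cs

  weight-split : ∀ (a : ℤ) (b : Bool) (M h l : ℕ) →
                 a * (+ M - + (if b then h else l)) ≡ a * (+ M - + l) + - ((+ h - + l) * (a * 𝟙 b))
  weight-split a true  M h l = identity a (+ M) (+ h) (+ l)
    where
    identity : ∀ a x y z → a * (x - y) ≡ a * (x - z) + - ((y - z) * (a * 1ℤ))
    identity = solve-∀
  weight-split a false M h l = identity a (+ M) (+ h) (+ l)
    where
    identity : ∀ a x y z → a * (x - z) ≡ a * (x - z) + - ((y - z) * (a * 0ℤ))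
    identity = solve-∀

  ≤-[h-l]* : ∀ P {l h} → l ℕ.< h → + P ≤ (+ h - + l) * + P
  ≤-[h-l]* P {l} {h} l<h rewrite ℤ.m-n≡m⊖n h l | ℤ.⊖-≥ (ℕ.<⇒≤ l<h) | sym (ℤ.pos-* (h ℕ.∸ l) P) =
    +≤+ (ℕ.m≤n*m P (h ℕ.∸ l) {{ℕ.>-nonZero (ℕ.m<n⇒0<n∸m l<h)}})

  module Witnesses {n m : ℕ} (𝒮 : Scheme n m) (contrast : PositiveContrast 𝒮) where

    open Scheme 𝒮
    open ≡-Reasoning

    positiveFamily : Subset n → Family n
    positiveFamily W S = inSb S ∧ (1ℤ ≤ᵇ symMöbius W S)

    positiveFamily-⊆𝔖 : ∀ W → IsSubFamily (positiveFamily W)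
    positiveFamily-⊆𝔖 W S S∈𝔗 = proj₁ (Equivalence.to T-∧ (Equivalence.from T-≡ S∈𝔗))

    witness : (W : Subset n) → ∃ λ B → B ∈ C (positiveFamily W)
    witness W with C (positiveFamily W) | nonempty (positiveFamily W) (positiveFamily-⊆𝔖 W)
    ... | []    | C≢[] = contradiction refl C≢[]
    ... | B ∷ _ | _    = B , here refl

    blanks : Subset n → Subset n → ℤ
    blanks W S = + m - + weight (orRows S (proj₁ (witness W)))

    Φ : Subset n → Subset n → ℤ
    Φ W S = symMöbius W S * blanks W S

    ∑-Φ-nonneg : ∀ W → 0ℤ ≤ ∑[ S ⊆ n ] Φ W S
    ∑-Φ-nonneg W = subst (0ℤ ≤_)
      (∑-cong λ S → cong (λ k → symMöbius W S * (+ m - + k)) (sym (weight-orRows S B)))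
      (∑-blanks-nonneg (symMöbius W) (∑-symMöbius-disjoint W) (columns B))
      where B = proj₁ (witness W)

    ∑-Φ-⊥ : ∑[ W ⊆ n ] Φ W ⊥ ≡ + m + + m
    ∑-Φ-⊥ = begin
      ∑[ W ⊆ n ] Φ W ⊥
        ≡⟨ ∑-cong {n} (λ W → trans (cong (symMöbius W ⊥ *_) (all-blank W)) (ℤ.*-comm (symMöbius W ⊥) (+ m))) ⟩
      ∑[ W ⊆ n ] (+ m * symMöbius W ⊥)
        ≡⟨ *-distribˡ-∑ {n} (+ m) (λ W → symMöbius W ⊥) ⟨
      + m * ∑[ W ⊆ n ] symMöbius W ⊥
        ≡⟨ cong (+ m *_) (trans (∑-symMöbius (⊥ {n})) (cong (λ b → 𝟙 b + 𝟙 b) (dec-true (⊥ {n} ≟ ⊥) refl))) ⟩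
      + m * + 2
        ≡⟨ ℤ.*-comm (+ m) (+ 2) ⟩
      + 2 * + m
        ≡⟨ 2*i≡i+i (+ m) ⟩
      + m + + m ∎
      where
      all-blank : ∀ W → blanks W ⊥ ≡ + m
      all-blank W = begin
        + m - + weight (orRows ⊥ B)          ≡⟨ cong (λ k → + m - + k) (weight-orRows ⊥ B) ⟩
        + m - + countᵇ (meets ⊥) (columns B) ≡⟨ cong (λ k → + m - + k) (countᵇ-meets-⊥ (columns B)) ⟩
        + m + 0ℤ                             ≡⟨ ℤ.+-identityʳ (+ m) ⟩
        + m                                  ∎
        where B = proj₁ (witness W)

    ∑-Φ-⊤ : parity (⊤ {n}) ≡ true → ∑[ W ⊆ n ] Φ W ⊤ ≡ 0ℤ
    ∑-Φ-⊤ odd = trans (∑-cong λ W → cong (_* blanks W ⊤) (symMöbius-⊤ odd W)) (∑-zero {n})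

    ∑-Φ-𝔖≡ : ∀ S → InS S → ∑[ W ⊆ n ] Φ W S ≡ - ((+ h S - + l S) * + (2 ℕ.^ Subset.∣ S ∣))
    ∑-Φ-𝔖≡ S S∈𝔖 = begin
      ∑[ W ⊆ n ] Φ W S
        ≡⟨ ∑-cong {n} (λ W → trans (cong (λ k → A W * (+ m - + k)) (weight-witness W))
                                   (weight-split (A W) _ m (h S) (l S))) ⟩
      ∑[ W ⊆ n ] (A W * (+ m - + l S) + - (gap * A⁺ W))
        ≡⟨ ∑-distrib-+ (λ W → A W * (+ m - + l S)) (λ W → - (gap * A⁺ W)) ⟩
      ∑[ W ⊆ n ] (A W * (+ m - + l S)) + ∑[ W ⊆ n ] (- (gap * A⁺ W))
        ≡⟨ cong₂ _+_ (∑-cong {n} λ W → ℤ.*-comm (A W) (+ m - + l S)) (∑-neg (λ W → gap * A⁺ W)) ⟩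
      ∑[ W ⊆ n ] ((+ m - + l S) * A W) + - ∑[ W ⊆ n ] (gap * A⁺ W)
        ≡⟨ cong₂ (λ x y → x + - y) (*-distribˡ-∑ (+ m - + l S) A) (*-distribˡ-∑ gap A⁺) ⟨
      (+ m - + l S) * ∑ A + - (gap * ∑ A⁺)
        ≡⟨ cong₂ (λ x y → (+ m - + l S) * x + - (gap * y))
                 (∑-symMöbius-𝔖 S S∈𝔖) (∑-positivePart S S∈𝔖) ⟩
      (+ m - + l S) * 0ℤ + - (gap * + (2 ℕ.^ Subset.∣ S ∣))
        ≡⟨ cong (_+ - (gap * + (2 ℕ.^ Subset.∣ S ∣))) (ℤ.*-zeroʳ (+ m - + l S)) ⟩
      0ℤ + - (gap * + (2 ℕ.^ Subset.∣ S ∣))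
        ≡⟨ ℤ.+-identityˡ _ ⟩
      - (gap * + (2 ℕ.^ Subset.∣ S ∣)) ∎
      where
      A A⁺ : Subset n → ℤ
      A W = symMöbius W S
      A⁺ W = A W * 𝟙 (1ℤ ≤ᵇ A W)
      gap : ℤ
      gap = + h S - + l S
      weight-witness : ∀ W → weight (orRows S (proj₁ (witness W))) ≡ (if 1ℤ ≤ᵇ A W then h S else l S)
      weight-witness W = trans
        (weights (positiveFamily W) (positiveFamily-⊆𝔖 W) (proj₁ (witness W)) (proj₂ (witness W)) S S∈𝔖)
        (cong (λ b → if b ∧ (1ℤ ≤ᵇ A W) then h S else l S) (Equivalence.to T-≡ S∈𝔖))

    ∑-Φ-𝔖 : ∀ S → InS S → ∑[ W ⊆ n ] Φ W S ≤ - + (2 ℕ.^ Subset.∣ S ∣)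
    ∑-Φ-𝔖 S S∈𝔖 = subst (_≤ - + (2 ℕ.^ Subset.∣ S ∣)) (sym (∑-Φ-𝔖≡ S S∈𝔖))
                         (ℤ.neg-mono-≤ (≤-[h-l]* (2 ℕ.^ Subset.∣ S ∣) (contrast S S∈𝔖)))

  ∑-𝔖-neg : ∀ n → ∑[ S ⊆ n ] (if inSb S then - + (2 ℕ.^ Subset.∣ S ∣) else 0ℤ)
                  ≡ - + (2 ℕ.* drosteExpansion n)
  ∑-𝔖-neg n = begin
    ∑[ S ⊆ n ] (if inSb S then - + (2 ℕ.^ Subset.∣ S ∣) else 0ℤ)
      ≡⟨ ∑-cong {n} (λ S → neg-if (inSb S)) ⟩
    ∑[ S ⊆ n ] (- + (if inSb S then 2 ℕ.^ Subset.∣ S ∣ else 0))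
      ≡⟨ ∑-neg {n} (λ S → + (if inSb S then 2 ℕ.^ Subset.∣ S ∣ else 0)) ⟩
    - ∑[ S ⊆ n ] (+ (if inSb S then 2 ℕ.^ Subset.∣ S ∣ else 0))
      ≡⟨ cong -_ (+-∑ {n} (λ S → if inSb S then 2 ℕ.^ Subset.∣ S ∣ else 0)) ⟨
    - + ℕΣ.∑[ S ⊆ n ] (if inSb S then 2 ℕ.^ Subset.∣ S ∣ else 0)
      ≡⟨ cong (-_ ∘ +_) (2*drosteExpansion n) ⟨
    - + (2 ℕ.* drosteExpansion n) ∎
    where
    open ≡-Reasoning
    neg-if : ∀ {x} b → (if b then - + x else 0ℤ) ≡ - + (if b then x else 0)
    neg-if true  = refl
    neg-if false = refl

  drosteExpansion≤ : ∀ {n m} (𝒮 : Scheme n m) → PositiveContrast 𝒮 → parity (⊤ {n}) ≡ true →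
                     drosteExpansion n ℕ.≤ m
  drosteExpansion≤ {suc k} {m} 𝒮 contrast odd = ℕ.*-cancelˡ-≤ 2 (ℤ.drop‿+≤+ (ℤ.0≤i-j⇒j≤i (begin
    0ℤ
      ≤⟨ subst₂ _≤_ (∑-zero {suc k}) (∑-comm Φ) (∑-mono-≤ ∑-Φ-nonneg) ⟩
    ∑[ S ⊆ suc k ] ∑[ W ⊆ suc k ] Φ W S
      ≡⟨ ∑-split-𝔖 F ⟩
    ∑[ S ⊆ suc k ] (if inSb S then F S else 0ℤ) + (F ⊤ + F ⊥)
      ≤⟨ ℤ.+-mono-≤ (∑-mono-≤ bound-𝔖) (ℤ.≤-reflexive (cong₂ _+_ (∑-Φ-⊤ odd) ∑-Φ-⊥)) ⟩
    ∑[ S ⊆ suc k ] (if inSb S then - + (2 ℕ.^ Subset.∣ S ∣) else 0ℤ) + (0ℤ + (+ m + + m))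
      ≡⟨ cong₂ _+_ (∑-𝔖-neg (suc k)) (ℤ.+-identityˡ _) ⟩
    - + (2 ℕ.* D) + (+ m + + m)
      ≡⟨ cong (_+_ (- + (2 ℕ.* D))) (trans (sym (2*i≡i+i (+ m))) (sym (ℤ.pos-* 2 m))) ⟩
    - + (2 ℕ.* D) + + (2 ℕ.* m)
      ≡⟨ ℤ.+-comm (- + (2 ℕ.* D)) (+ (2 ℕ.* m)) ⟩
    + (2 ℕ.* m) - + (2 ℕ.* D) ∎)))
    where
    open Witnesses 𝒮 contrast
    open ℤ.≤-Reasoning
    D = drosteExpansion (suc k)
    F : Subset (suc k) → ℤ
    F S = ∑[ W ⊆ suc k ] Φ W S
    bound-𝔖 : ∀ S → (if inSb S then F S else 0ℤ) ≤ (if inSb S then - + (2 ℕ.^ Subset.∣ S ∣) else 0ℤ)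
    bound-𝔖 S with inSb S in S∈𝔖
    ... | true  = ∑-Φ-𝔖 S (Equivalence.from T-≡ S∈𝔖)
    ... | false = ℤ.≤-refl

-- Permutations of a list
module _ where

  open import Data.List using (List; []; _∷_; [_]; map; _++_; concatMap)
  open import Data.List.Effectful using (module MonadProperties)
  open import Data.List.Membership.Propositional using (_∈_; find)
  open import Data.List.Membership.Propositional.Properties using (∈-map⁻; ∈-concatMap⁻; ∈-concatMap⁺)
  open import Data.List.Properties using (concatMap-map; map-concatMap; map-∘; map-++; concatMap-cong; ++-assoc)
  open import Data.List.Relation.Binary.Permutation.Propositional
    using (_↭_; ↭-refl; ↭-trans; ↭-prep; ↭-swap; refl; prep; swap; trans; module PermutationReasoning)
  open import Data.List.Relation.Binary.Permutation.Propositional.Properties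
    using (++⁺ˡ; ++⁺; ++-comm; shifts; map⁺; drop-∷)
  import Data.List.Relation.Unary.Any as Any
  open import Data.List.Relation.Unary.Any using (here; there)

  private
    variable
      A B : Set
      x y : A
      xs ys : List A

  concatMap-↭ : (f : A → List B) → xs ↭ ys → concatMap f xs ↭ concatMap f ys
  concatMap-↭ f refl          = ↭-refl
  concatMap-↭ f (prep x p)    = ++⁺ˡ (f x) (concatMap-↭ f p)
  concatMap-↭ f (swap x y p)  = ↭-trans (shifts (f x) (f y)) (++⁺ˡ (f y) (++⁺ˡ (f x) (concatMap-↭ f p)))
  concatMap-↭ f (trans p q)   = ↭-trans (concatMap-↭ f p) (concatMap-↭ f q)

  concatMap-cong-↭ : {f g : A → List B} → (∀ x → f x ↭ g x) → ∀ xs → concatMap f xs ↭ concatMap g xs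
  concatMap-cong-↭ f↭g []       = ↭-refl
  concatMap-cong-↭ f↭g (x ∷ xs) = ++⁺ (f↭g x) (concatMap-cong-↭ f↭g xs)

  concatMap-++-distrib : (f g : A → List B) → ∀ xs →
                         concatMap (λ x → f x ++ g x) xs ↭ concatMap f xs ++ concatMap g xs
  concatMap-++-distrib f g []       = ↭-refl
  concatMap-++-distrib f g (x ∷ xs) = begin
    (f x ++ g x) ++ concatMap (λ x → f x ++ g x) xs  ≡⟨ ++-assoc (f x) (g x) _ ⟩
    f x ++ (g x ++ concatMap (λ x → f x ++ g x) xs)  ↭⟨ ++⁺ˡ (f x) (++⁺ˡ (g x) (concatMap-++-distrib f g xs)) ⟩
    f x ++ (g x ++ (concatMap f xs ++ concatMap g xs)) ↭⟨ ++⁺ˡ (f x) (shifts (g x) (concatMap f xs)) ⟩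
    f x ++ (concatMap f xs ++ (g x ++ concatMap g xs)) ≡⟨ ++-assoc (f x) (concatMap f xs) _ ⟨
    (f x ++ concatMap f xs) ++ (g x ++ concatMap g xs) ∎
    where open PermutationReasoning

  ++-cancelˡ : ∀ zs {xs ys : List A} → zs ++ xs ↭ zs ++ ys → xs ↭ ys
  ++-cancelˡ []       p = p
  ++-cancelˡ (z ∷ zs) p = ++-cancelˡ zs (drop-∷ p)

  ++-cancelʳ : ∀ zs {xs ys : List A} → xs ++ zs ↭ ys ++ zs → xs ↭ ys
  ++-cancelʳ zs {xs} {ys} p = ++-cancelˡ zs (↭-trans (++-comm zs xs) (↭-trans p (++-comm ys zs)))

  insertions : A → List A → List (List A)
  insertions x []       = [ [ x ] ]
  insertions x (y ∷ ys) = (x ∷ y ∷ ys) ∷ map (y ∷_) (insertions x ys)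

  permutations : List A → List (List A)
  permutations []       = [ [] ]
  permutations (x ∷ xs) = concatMap (insertions x) (permutations xs)

  concatMap-insertions-map∷ : ∀ (x z : A) L → concatMap (insertions x) (map (z ∷_) L)
                              ↭ map (x ∷_) (map (z ∷_) L) ++ map (z ∷_) (concatMap (insertions x) L)
  concatMap-insertions-map∷ x z []      = ↭-refl
  concatMap-insertions-map∷ x z (w ∷ L) = ↭-prep (x ∷ z ∷ w) (begin
    map (z ∷_) (insertions x w) ++ concatMap (insertions x) (map (z ∷_) L)
      ↭⟨ ++⁺ˡ (map (z ∷_) (insertions x w)) (concatMap-insertions-map∷ x z L) ⟩
    map (z ∷_) (insertions x w) ++ (map (x ∷_) (map (z ∷_) L) ++ map (z ∷_) (concatMap (insertions x) L))
      ↭⟨ shifts (map (z ∷_) (insertions x w)) (map (x ∷_) (map (z ∷_) L)) ⟩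
    map (x ∷_) (map (z ∷_) L) ++ (map (z ∷_) (insertions x w) ++ map (z ∷_) (concatMap (insertions x) L))
      ≡⟨ cong (map (x ∷_) (map (z ∷_) L) ++_) (map-++ (z ∷_) (insertions x w) _) ⟨
    map (x ∷_) (map (z ∷_) L) ++ map (z ∷_) (insertions x w ++ concatMap (insertions x) L) ∎)
    where open PermutationReasoning

  insertions-comm : ∀ (x y : A) zs →
                    concatMap (insertions x) (insertions y zs) ↭ concatMap (insertions y) (insertions x zs)
  insertions-comm x y []       = ↭-swap _ _ ↭-refl
  insertions-comm x y (z ∷ zs) = begin
    concatMap (insertions x) (insertions y (z ∷ zs))
      ↭⟨ ↭-prep _ (↭-prep _ (++⁺ˡ Px (concatMap-insertions-map∷ x z (insertions y zs)))) ⟩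
    (x ∷ y ∷ z ∷ zs) ∷ (y ∷ x ∷ z ∷ zs) ∷ (Px ++ (Py ++ map (z ∷_) (concatMap (insertions x) (insertions y zs))))
      ↭⟨ ↭-swap _ _ (↭-trans (shifts Px Py) (++⁺ˡ Py (++⁺ˡ Px (map⁺ (z ∷_) (insertions-comm x y zs))))) ⟩
    (y ∷ x ∷ z ∷ zs) ∷ (x ∷ y ∷ z ∷ zs) ∷ (Py ++ (Px ++ map (z ∷_) (concatMap (insertions y) (insertions x zs))))
      ↭⟨ ↭-prep _ (↭-prep _ (++⁺ˡ Py (concatMap-insertions-map∷ y z (insertions x zs)))) ⟨
    concatMap (insertions y) (insertions x (z ∷ zs)) ∎
    where
    open PermutationReasoning
    Px = map (y ∷_) (map (z ∷_) (insertions x zs))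
    Py = map (x ∷_) (map (z ∷_) (insertions y zs))

  permutations-↭ : xs ↭ ys → permutations xs ↭ permutations ys
  permutations-↭ refl                    = ↭-refl
  permutations-↭ (prep x p)              = concatMap-↭ (insertions x) (permutations-↭ p)
  permutations-↭ (swap {xs} {ys} x y p)  = begin
    concatMap (insertions x) (concatMap (insertions y) (permutations xs))
      ≡⟨ MonadProperties.associative (permutations xs) (insertions y) (insertions x) ⟨
    concatMap (concatMap (insertions x) ∘ insertions y) (permutations xs)
      ↭⟨ concatMap-cong-↭ (insertions-comm x y) (permutations xs) ⟩
    concatMap (concatMap (insertions y) ∘ insertions x) (permutations xs)
      ≡⟨ MonadProperties.associative (permutations xs) (insertions x) (insertions y) ⟩
    concatMap (insertions y) (concatMap (insertions x) (permutations xs))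
      ↭⟨ concatMap-↭ (insertions y) (concatMap-↭ (insertions x) (permutations-↭ p)) ⟩
    concatMap (insertions y) (concatMap (insertions x) (permutations ys)) ∎
    where open PermutationReasoning
  permutations-↭ (trans p q)             = ↭-trans (permutations-↭ p) (permutations-↭ q)

  ∈-insertions⁻ : ∀ {π} (x : A) ys → π ∈ insertions x ys → π ↭ x ∷ ys
  ∈-insertions⁻ x []       (here refl) = ↭-refl
  ∈-insertions⁻ x (y ∷ ys) (here refl) = ↭-refl
  ∈-insertions⁻ x (y ∷ ys) (there π∈)  with ρ , ρ∈ , refl ← ∈-map⁻ (y ∷_) π∈ =
    ↭-trans (↭-prep y (∈-insertions⁻ x ys ρ∈)) (↭-swap y x ↭-refl)

  ∈-permutations⁻ : ∀ {π} (xs : List A) → π ∈ permutations xs → π ↭ xs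
  ∈-permutations⁻ []       (here refl) = ↭-refl
  ∈-permutations⁻ (x ∷ xs) π∈
    with ρ , ρ∈ , π∈ins ← find (∈-concatMap⁻ (insertions x) {xs = permutations xs} π∈) =
    ↭-trans (∈-insertions⁻ x ρ π∈ins) (↭-prep x (∈-permutations⁻ xs ρ∈))

  ∈-permutations-self : (xs : List A) → xs ∈ permutations xs
  ∈-permutations-self []       = here refl
  ∈-permutations-self (x ∷ xs) =
    ∈-concatMap⁺ (insertions x) (Any.map (λ { refl → head∈ xs }) (∈-permutations-self xs))
    where
    head∈ : ∀ ys → x ∷ ys ∈ insertions x ys
    head∈ []      = here refl
    head∈ (_ ∷ _) = here refl

  insertions-map : ∀ (f : A → B) x ys → insertions (f x) (map f ys) ≡ map (map f) (insertions x ys)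
  insertions-map f x []       = refl
  insertions-map f x (y ∷ ys) = cong ((f x ∷ f y ∷ map f ys) ∷_) (begin
    map (f y ∷_) (insertions (f x) (map f ys))   ≡⟨ cong (map (f y ∷_)) (insertions-map f x ys) ⟩
    map (f y ∷_) (map (map f) (insertions x ys)) ≡⟨ map-∘ (insertions x ys) ⟨
    map (map f ∘ (y ∷_)) (insertions x ys)       ≡⟨ map-∘ (insertions x ys) ⟩
    map (map f) (map (y ∷_) (insertions x ys))   ∎)
    where open ≡-Reasoning

  permutations-map : ∀ (f : A → B) xs → permutations (map f xs) ≡ map (map f) (permutations xs)
  permutations-map f []       = refl
  permutations-map f (x ∷ xs) = begin
    concatMap (insertions (f x)) (permutations (map f xs))
      ≡⟨ cong (concatMap (insertions (f x))) (permutations-map f xs) ⟩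
    concatMap (insertions (f x)) (map (map f) (permutations xs))
      ≡⟨ concatMap-map (insertions (f x)) (map f) (permutations xs) ⟩
    concatMap (insertions (f x) ∘ map f) (permutations xs)
      ≡⟨ concatMap-cong (insertions-map f x) (permutations xs) ⟩
    concatMap (map (map f) ∘ insertions x) (permutations xs)
      ≡⟨ map-concatMap (map f) (insertions x) (permutations xs) ⟨
    map (map f) (concatMap (insertions x) (permutations xs)) ∎
    where open ≡-Reasoning

-- Construction for even n
module _ where

  open import Data.Bool.Properties using (T-≡; not-involutive)
  open import Data.Fin.Subset using (_∈_; _∉_; ∣_∣)
  open import Data.Fin.Subset.Properties using (⊆-antisym; ∈⊤; x∈∁p⇒x∉p; ∩-zeroʳ)
  open import Data.Bool.ListAction using (all; and)
  open import Data.List as List using (List; []; _∷_; [_]; map; _++_; concatMap; length)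
  open import Data.List.Membership.Propositional using () renaming (_∈_ to _∈ˡ_)
  open import Data.List.Membership.Propositional.Properties
    using (∈-++⁺ˡ; ∈-++⁺ʳ; ∈-map⁺; ∈-map⁻; ∈-concatMap⁺)
  open import Data.List.Properties
    using (map-++; map-∘; map-cong; ++-assoc; length-++; length-map; concatMap-map; map-concatMap; concatMap-cong)
  open import Data.List.Relation.Binary.Permutation.Propositional
    using (_↭_; ↭-refl; ↭-sym; ↭-trans; ↭-prep; ↭-swap; ↭-reflexive; module PermutationReasoning)
  open import Data.List.Relation.Binary.Permutation.Propositional.Properties
    using (++⁺ˡ; ++⁺ʳ; ++⁺; ++-comm; shift; map⁺; ↭-length; drop-∷)
  open import Data.List.Relation.Unary.All as All using (All; []; _∷_)
  import Data.List.Relation.Unary.All.Properties as All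
  import Data.List.Relation.Unary.Any as Any
  open import Data.List.Relation.Unary.Any using (here; there)
  open import Data.Nat using (_+_; _*_; _∸_; _^_; _≤_; _<_; pred; z≤n; s≤s)
  open import Data.Nat.ListAction using (sum)
  open import Data.Nat.ListAction.Properties using (sum-++; sum-↭)
  open import Data.Nat.Properties
    using ( +-comm; +-identityʳ; +-assoc; +-suc; +-cancelʳ-≡; +-*-commutativeSemiring
          ; n<1+n; n≤1+n; suc-injective; m≤n⇒m≤1+n)
  open import Data.Vec as Vec using (countᵇ)
  open import Data.Vec.Properties using (map-replicate)
  open import Relation.Nullary using (yes; no)
  open import Relation.Nullary.Decidable using (dec-true)

  private
    module ℕΣ = SubsetSum +-*-commutativeSemiring
    variable
      A B : Set
      n : ℕ

  count : (A → Bool) → List A → ℕ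
  count p xs = sum (map (λ x → if p x then 1 else 0) xs)

  count-++ : ∀ (p : A → Bool) xs ys → count p (xs ++ ys) ≡ count p xs + count p ys
  count-++ p xs ys = trans (cong sum (map-++ _ xs ys)) (sum-++ (map _ xs) _)

  count-map : ∀ (p : B → Bool) (f : A → B) xs → count p (map f xs) ≡ count (p ∘ f) xs
  count-map p f xs = cong sum (sym (map-∘ xs))

  count-↭ : ∀ (p : A → Bool) {xs ys} → xs ↭ ys → count p xs ≡ count p ys
  count-↭ p xs↭ys = sum-↭ (map⁺ _ xs↭ys)

  count-↭-map : ∀ (p : A → Bool) {xs ys} → map p xs ↭ map p ys → count p xs ≡ count p ys
  count-↭-map p {xs} {ys} pxs↭pys =
    trans (sym (count-map (λ b → b) p xs)) (trans (count-↭ (λ b → b) pxs↭pys) (count-map (λ b → b) p ys))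

  count-all : ∀ {p : A → Bool} {xs} → All (λ x → p x ≡ true) xs → count p xs ≡ length xs
  count-all []               = refl
  count-all (px ∷ pxs) rewrite px = cong suc (count-all pxs)

  count-≤-length : ∀ (p : A → Bool) xs → count p xs ≤ length xs
  count-≤-length p []       = z≤n
  count-≤-length p (x ∷ xs) with p x
  ... | true  = s≤s (count-≤-length p xs)
  ... | false = m≤n⇒m≤1+n (count-≤-length p xs)

  count-concatMap : ∀ (p : B → Bool) (f : A → List B) xs →
                    count p (concatMap f xs) ≡ sum (map (count p ∘ f) xs)
  count-concatMap p f []       = refl
  count-concatMap p f (x ∷ xs) =
    trans (count-++ p (f x) (concatMap f xs)) (cong (count p (f x) +_) (count-concatMap p f xs))

  all-false : ∀ (p : A → Bool) xs → all p xs ≡ false → ∃ λ x → x ∈ˡ xs × p x ≡ false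
  all-false p (x ∷ xs) all≡false with p x in px
  ... | false = x , here refl , px
  ... | true  with y , y∈xs , py ← all-false p xs all≡false = y , there y∈xs , py

  ∈⇒≢[] : ∀ {x : A} {xs} → x ∈ˡ xs → xs ≢ []
  ∈⇒≢[] (here _)  ()
  ∈⇒≢[] (there _) ()

  branch : List (Subset n) → List (Subset n) → List (Subset (suc n))
  branch Ys Ns = map (true ∷_) Ys ++ map (false ∷_) Ns

  length-branch : ∀ (Ys Ns : List (Subset n)) → length (branch Ys Ns) ≡ length Ys + length Ns
  length-branch Ys Ns = trans (length-++ (map (true ∷_) Ys)) (cong₂ _+_ (length-map _ Ys) (length-map _ Ns))

  count-branch : ∀ (p : Subset (suc n) → Bool) Ys Ns →
                 count p (branch Ys Ns) ≡ count (p ∘ (true ∷_)) Ys + count (p ∘ (false ∷_)) Ns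
  count-branch p Ys Ns = trans (count-++ p (map (true ∷_) Ys) _) (cong₂ _+_ (count-map p _ Ys) (count-map p _ Ns))

  branch⁺ : ∀ {Ys Ys′ Ns Ns′ : List (Subset n)} → Ys ↭ Ys′ → Ns ↭ Ns′ →
            branch Ys Ns ↭ branch Ys′ Ns′
  branch⁺ Ys↭ Ns↭ = ++⁺ (map⁺ _ Ys↭) (map⁺ _ Ns↭)

  flip-zero-branch : ∀ (Ys Ns : List (Subset n)) → map (flip zero) (branch Ys Ns) ↭ branch Ns Ys
  flip-zero-branch Ys Ns = ↭-trans
    (↭-reflexive (trans (map-++ (flip zero) (map (true ∷_) Ys) _) (cong₂ _++_ (sym (map-∘ Ys)) (sym (map-∘ Ns)))))
    (++-comm (map (false ∷_) Ys) (map (true ∷_) Ns))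

  flip-suc-branch : ∀ (j : Fin n) Ys Ns →
                    map (flip (suc j)) (branch Ys Ns) ≡ branch (map (flip j) Ys) (map (flip j) Ns)
  flip-suc-branch j Ys Ns = trans (map-++ (flip (suc j)) (map (true ∷_) Ys) _)
    (cong₂ _++_ (trans (sym (map-∘ Ys)) (map-∘ Ys)) (trans (sym (map-∘ Ns)) (map-∘ Ns)))

  ∈-allSubsets : ∀ (S : Subset n) → S ∈ˡ allSubsets n
  ∈-allSubsets []                  = here refl
  ∈-allSubsets (true  ∷ S)         = ∈-++⁺ˡ (∈-map⁺ (true ∷_) (∈-allSubsets S))
  ∈-allSubsets {suc n} (false ∷ S) =
    ∈-++⁺ʳ (map (true ∷_) (allSubsets n)) (∈-map⁺ (false ∷_) (∈-allSubsets S))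

  allSubsets-flip : ∀ (j : Fin n) → map (flip j) (allSubsets n) ↭ allSubsets n
  allSubsets-flip {suc n} zero    = flip-zero-branch (allSubsets n) (allSubsets n)
  allSubsets-flip {suc n} (suc j) = ↭-trans (↭-reflexive (flip-suc-branch j (allSubsets n) (allSubsets n)))
                                            (branch⁺ (allSubsets-flip j) (allSubsets-flip j))

  -- block T t lists Droste's columns for T: Y ∪ ∁T for the Y ⊆ T with |Y| odd iff t.
  block : Subset n → Bool → List (Subset n)
  block []          t = if t then [] else [ [] ]
  block (true  ∷ T) t = branch (block T (not t)) (block T t)
  block (false ∷ T) t = map (true ∷_) (block T t)

  length-block-+ : ∀ (T : Subset n) → length (block T true) + length (block T false) ≡ 2 ^ ∣ T ∣
  length-block-+ []          = refl
  length-block-+ (true  ∷ T) = begin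
    length (branch (block T false) (block T true)) + length (branch (block T true) (block T false))
      ≡⟨ cong₂ _+_ (length-branch (block T false) _) (length-branch (block T true) _) ⟩
    (length (block T false) + length (block T true)) + (length (block T true) + length (block T false))
      ≡⟨ cong₂ _+_ (trans (+-comm (length (block T false)) _) (length-block-+ T))
                   (trans (length-block-+ T) (sym (+-identityʳ _))) ⟩
    2 ^ ∣ T ∣ + (2 ^ ∣ T ∣ + 0) ∎
    where open ≡-Reasoning
  length-block-+ (false ∷ T) =
    trans (cong₂ _+_ (length-map _ (block T true)) (length-map _ (block T false))) (length-block-+ T)

  length-block : ∀ (T : Subset n) t → Nonempty T → length (block T t) ≡ 2 ^ (∣ T ∣ ∸ 1)
  length-block (true  ∷ T) t _ = trans (length-branch (block T (not t)) (block T t)) (halves t)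
    where
    halves : ∀ t → length (block T (not t)) + length (block T t) ≡ 2 ^ ∣ T ∣
    halves true  = trans (+-comm (length (block T false)) _) (length-block-+ T)
    halves false = length-block-+ T
  length-block (false ∷ T) t (suc j , there j∈T) = trans (length-map _ (block T t)) (length-block T t (j , j∈T))

  ∈-block : ∀ {j : Fin n} (T : Subset n) t → j ∉ T → All (j ∈_) (block T t)
  ∈-block {j = zero}  (true  ∷ T) t zero∉T = contradiction here zero∉T
  ∈-block {j = zero}  (false ∷ T) t _      = All.map⁺ (All.universal (λ _ → here) (block T t))
  ∈-block {j = suc j} (true  ∷ T) t j∉T    =
    All.++⁺ (All.map⁺ (All.map there (∈-block T (not t) (j∉T ∘ there))))
            (All.map⁺ (All.map there (∈-block T t (j∉T ∘ there))))
  ∈-block {j = suc j} (false ∷ T) t j∉T    = All.map⁺ (All.map there (∈-block T t (j∉T ∘ there)))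

  count-meets-block-∉ : ∀ {j : Fin n} {S} (T : Subset n) t → j ∈ S → j ∉ T →
                        count (meets S) (block T t) ≡ length (block T t)
  count-meets-block-∉ T t j∈S j∉T = count-all (All.map (meets-∈ j∈S) (∈-block T t j∉T))

  count-meets-block-self : ∀ (T : Subset n) t →
                           count (meets T) (block T t) + (if t then 0 else 1) ≡ length (block T t)
  count-meets-block-self []          true  = refl
  count-meets-block-self []          false = refl
  count-meets-block-self (true  ∷ T) t     = begin
    count (meets (true ∷ T)) (branch (block T (not t)) (block T t)) + [¬t]
      ≡⟨ cong (_+ [¬t]) (count-branch (meets (true ∷ T)) (block T (not t)) (block T t)) ⟩
    count (λ _ → true) (block T (not t)) + count (meets T) (block T t) + [¬t]
      ≡⟨ +-assoc (count (λ _ → true) (block T (not t))) _ [¬t] ⟩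
    count (λ _ → true) (block T (not t)) + (count (meets T) (block T t) + [¬t])
      ≡⟨ cong₂ _+_ (count-all (All.universal (λ _ → refl) (block T (not t)))) (count-meets-block-self T t) ⟩
    length (block T (not t)) + length (block T t)
      ≡⟨ length-branch (block T (not t)) (block T t) ⟨
    length (branch (block T (not t)) (block T t)) ∎
    where
    open ≡-Reasoning
    [¬t] = if t then 0 else 1
  count-meets-block-self (false ∷ T) t     =
    trans (cong (_+ (if t then 0 else 1)) (count-map _ (true ∷_) (block T t)))
          (trans (count-meets-block-self T t) (sym (length-map _ (block T t))))

  flip-block : ∀ {j : Fin n} (T : Subset n) t → j ∈ T → map (flip j) (block T t) ↭ block T (not t)
  flip-block (true ∷ T) t here rewrite not-involutive t = flip-zero-branch (block T (not t)) (block T t)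
  flip-block {j = suc j} (true ∷ T) t (there j∈T) =
    ↭-trans (↭-reflexive (flip-suc-branch j (block T (not t)) (block T t)))
            (branch⁺ (flip-block T (not t) j∈T) (flip-block T t j∈T))
  flip-block {j = suc j} (false ∷ T) t (there j∈T) =
    ↭-trans (↭-reflexive (trans (sym (map-∘ (block T t))) (map-∘ (block T t))))
            (map⁺ (true ∷_) (flip-block T t j∈T))

  map-block-flip : ∀ {j : Fin n} {f : Subset n → B} (T : Subset n) → j ∈ T →
                   (∀ X → f (flip j X) ≡ f X) → ∀ t → map f (block T t) ↭ map f (block T (not t))
  map-block-flip T j∈T f∘flip≗f t = ↭-trans
    (↭-reflexive (trans (map-cong (sym ∘ f∘flip≗f) (block T t)) (map-∘ (block T t))))
    (map⁺ _ (flip-block T t j∈T))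

  map-block-independent : ∀ {j : Fin n} {f : Subset n → B} (T : Subset n) → j ∈ T →
                          (∀ X → f (flip j X) ≡ f X) → ∀ t t′ → map f (block T t) ↭ map f (block T t′)
  map-block-independent T j∈T f∘flip≗f true  true  = ↭-refl
  map-block-independent T j∈T f∘flip≗f false false = ↭-refl
  map-block-independent T j∈T f∘flip≗f true  false = map-block-flip T j∈T f∘flip≗f true
  map-block-independent T j∈T f∘flip≗f false true  = map-block-flip T j∈T f∘flip≗f false

  -- If T ⊈ S, flipping a coordinate in T ∖ S exchanges the two blocks and is invisible to S;
  -- if T ⊂ S, every column of either block meets S.
  count-meets-block-independent : ∀ {S} (T : Subset n) → InS T → T ≢ S → ∀ t →
                                  count (meets S) (block T t) ≡ count (meets S) (block T false)
  count-meets-block-independent {S = S} T T∈𝔖 T≢S t with ⊆-or-witness T S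
  ... | inj₂ (j , j∈T , j∉S) = count-↭-map (meets S) (map-block-independent T j∈T (meets-flip j∉S) t false)
  ... | inj₁ T⊆S with ⊆-or-witness S T
  ...   | inj₁ S⊆T             = contradiction (⊆-antisym T⊆S S⊆T) T≢S
  ...   | inj₂ (j , j∈S , j∉T) = begin
    count (meets S) (block T t)      ≡⟨ count-meets-block-∉ T t j∈S j∉T ⟩
    length (block T t)               ≡⟨ length-block T t (InS⇒Nonempty T T∈𝔖) ⟩
    2 ^ (∣ T ∣ ∸ 1)                  ≡⟨ length-block T false (InS⇒Nonempty T T∈𝔖) ⟨
    length (block T false)           ≡⟨ count-meets-block-∉ T false j∈S j∉T ⟨
    count (meets S) (block T false)  ∎
    where open ≡-Reasoning

  count-meets-block-true : ∀ (S : Subset n) → Nonempty S →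
                           count (meets S) (block S true) ≡ suc (count (meets S) (block S false))
  count-meets-block-true S S≢⊥ = begin
    count (meets S) (block S true)       ≡⟨ +-identityʳ _ ⟨
    count (meets S) (block S true) + 0   ≡⟨ count-meets-block-self S true ⟩
    length (block S true)                ≡⟨ trans (length-block S true S≢⊥) (sym (length-block S false S≢⊥)) ⟩
    length (block S false)               ≡⟨ count-meets-block-self S false ⟨
    count (meets S) (block S false) + 1  ≡⟨ +-comm _ 1 ⟩
    suc (count (meets S) (block S false)) ∎
    where open ≡-Reasoning

  drosteBlock : Family n → Subset n → List (Subset n)
  drosteBlock 𝔗 T = if inSb T then block T (𝔗 T) else []

  drosteColumns : Family n → List (Subset n)
  drosteColumns {n} 𝔗 = concatMap (drosteBlock 𝔗) (allSubsets n)

  length-drosteColumns : ∀ (𝔗 : Family n) → length (drosteColumns 𝔗) ≡ drosteExpansion n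
  length-drosteColumns {n} 𝔗 = begin
    length (drosteColumns 𝔗)
      ≡⟨ count-all (All.universal (λ _ → refl) (drosteColumns 𝔗)) ⟨
    count (λ _ → true) (drosteColumns 𝔗)
      ≡⟨ count-concatMap (λ _ → true) (drosteBlock 𝔗) (allSubsets n) ⟩
    sum (map (count (λ _ → true) ∘ drosteBlock 𝔗) (allSubsets n))
      ≡⟨ cong sum (map-cong blockSize (allSubsets n)) ⟩
    drosteExpansion n ∎
    where
    open ≡-Reasoning
    blockSize : ∀ T → count (λ _ → true) (drosteBlock 𝔗 T) ≡ (if inSb T then 2 ^ (∣ T ∣ ∸ 1) else 0)
    blockSize T with inSb T in T∈𝔖
    ... | false = refl
    ... | true  = trans (count-all (All.universal (λ _ → refl) (block T (𝔗 T))))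
                        (length-block T (𝔗 T) (InS⇒Nonempty T (Equivalence.from T-≡ T∈𝔖)))

  drosteColumns-balance : ∀ (𝔗 : Family n) S → InS S →
    count (meets S) (drosteColumns 𝔗) + count (meets S) (block S false)
    ≡ count (meets S) (drosteColumns (λ _ → false)) + count (meets S) (block S (𝔗 S))
  drosteColumns-balance {n} 𝔗 S S∈𝔖 = begin
    count (meets S) (drosteColumns 𝔗) + count (meets S) (block S false)
      ≡⟨ cong₂ _+_ (as-∑ 𝔗) (sym (S-block 𝔗₀)) ⟩
    ∑ (g 𝔗) + g 𝔗₀ S                  ≡⟨ ∑-update (g 𝔗) (g 𝔗₀) S off-S ⟩
    ∑ (g 𝔗₀) + g 𝔗 S                  ≡⟨ cong₂ _+_ (sym (as-∑ 𝔗₀)) (S-block 𝔗) ⟩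
    count (meets S) (drosteColumns 𝔗₀) + count (meets S) (block S (𝔗 S)) ∎
    where
    open ℕΣ
    open ≡-Reasoning
    𝔗₀ : Family n
    𝔗₀ _ = false
    g : Family n → Subset n → ℕ
    g 𝔗 T = count (meets S) (drosteBlock 𝔗 T)
    as-∑ : ∀ 𝔗 → count (meets S) (drosteColumns 𝔗) ≡ ∑ (g 𝔗)
    as-∑ 𝔗 = trans (count-concatMap (meets S) (drosteBlock 𝔗) (allSubsets n)) (sum-allSubsets n (g 𝔗))
    S-block : ∀ 𝔗 → g 𝔗 S ≡ count (meets S) (block S (𝔗 S))
    S-block 𝔗 = cong (λ b → count (meets S) (if b then block S (𝔗 S) else [])) (Equivalence.to T-≡ S∈𝔖)
    off-S : ∀ T → T ≢ S → g 𝔗 T ≡ g 𝔗₀ T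
    off-S T T≢S with inSb T in T∈𝔖
    ... | false = refl
    ... | true  = count-meets-block-independent T (Equivalence.from T-≡ T∈𝔖) T≢S (𝔗 T)

  count-meets-drosteColumns : ∀ (𝔗 : Family n) S → InS S →
    count (meets S) (drosteColumns 𝔗) ≡ (if 𝔗 S then suc (count (meets S) (drosteColumns (λ _ → false)))
                                                 else count (meets S) (drosteColumns (λ _ → false)))
  count-meets-drosteColumns 𝔗 S S∈𝔖 with 𝔗 S | drosteColumns-balance 𝔗 S S∈𝔖
  ... | true  | balance = +-cancelʳ-≡ _ _ _ (trans balance (trans
    (cong (count (meets S) (drosteColumns (λ _ → false)) +_) (count-meets-block-true S (InS⇒Nonempty S S∈𝔖)))
    (+-suc _ _)))
  ... | false | balance = +-cancelʳ-≡ _ _ _ balance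

  ∩-drosteColumns : ∀ (Q : Subset n) {𝔗 𝔗′} → AgreeOn Q 𝔗 𝔗′ →
                    map (Q ∩_) (drosteColumns 𝔗) ↭ map (Q ∩_) (drosteColumns 𝔗′)
  ∩-drosteColumns {n} Q {𝔗} {𝔗′} agree = begin
    map (Q ∩_) (concatMap (drosteBlock 𝔗) (allSubsets n))
      ≡⟨ map-concatMap (Q ∩_) (drosteBlock 𝔗) (allSubsets n) ⟩
    concatMap (map (Q ∩_) ∘ drosteBlock 𝔗) (allSubsets n)
      ↭⟨ concatMap-cong-↭ perBlock (allSubsets n) ⟩
    concatMap (map (Q ∩_) ∘ drosteBlock 𝔗′) (allSubsets n)
      ≡⟨ map-concatMap (Q ∩_) (drosteBlock 𝔗′) (allSubsets n) ⟨
    map (Q ∩_) (concatMap (drosteBlock 𝔗′) (allSubsets n)) ∎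
    where
    open PermutationReasoning
    perBlock : ∀ T → map (Q ∩_) (drosteBlock 𝔗 T) ↭ map (Q ∩_) (drosteBlock 𝔗′ T)
    perBlock T with inSb T in T∈𝔖
    ... | false = ↭-refl
    ... | true  with ⊆-or-witness T Q
    ...   | inj₁ T⊆Q             =
      ↭-reflexive (cong (λ t → map (Q ∩_) (block T t)) (agree T (Equivalence.from T-≡ T∈𝔖) T⊆Q))
    ...   | inj₂ (j , j∈T , j∉Q) = map-block-independent T j∈T (∩-flip j∉Q) (𝔗 T) (𝔗′ T)

  complementsOf : (Subset n → Bool) → List (Subset n)
  complementsOf {n} p = concatMap (λ T → if p T then [ ∁ T ] else []) (allSubsets n)

  map-complementsOf : ∀ (f : Subset n → B) p →
                      map f (complementsOf p) ≡ concatMap (λ T → if p T then [ f (∁ T) ] else []) (allSubsets n)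
  map-complementsOf {n} f p = trans (map-concatMap f _ (allSubsets n)) (concatMap-cong map-if (allSubsets n))
    where
    map-if : ∀ T → map f (if p T then [ ∁ T ] else []) ≡ (if p T then [ f (∁ T) ] else [])
    map-if T with p T
    ... | true  = refl
    ... | false = refl

  map-complements-flip : ∀ {B : Set} (j : Fin n) {f : Subset n → B} → (∀ X → f (flip j X) ≡ f X) →
                         map f (complementsOf parity) ↭ map f (complementsOf (not ∘ parity))
  map-complements-flip {n} {B} j {f} f∘flip≗f = begin
    map f (complementsOf parity)
      ≡⟨ map-complementsOf f parity ⟩
    concatMap (pick parity) (allSubsets n)
      ↭⟨ concatMap-↭ (pick parity) (allSubsets-flip j) ⟨
    concatMap (pick parity) (map (flip j) (allSubsets n))
      ≡⟨ concatMap-map (pick parity) (flip j) (allSubsets n) ⟩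
    concatMap (pick parity ∘ flip j) (allSubsets n)
      ≡⟨ concatMap-cong flipped (allSubsets n) ⟩
    concatMap (pick (not ∘ parity)) (allSubsets n)
      ≡⟨ map-complementsOf f (not ∘ parity) ⟨
    map f (complementsOf (not ∘ parity)) ∎
    where
    open PermutationReasoning
    pick : (Subset n → Bool) → Subset n → List B
    pick p T = if p T then [ f (∁ T) ] else []
    flipped : ∀ T → pick parity (flip j T) ≡ pick (not ∘ parity) T
    flipped T rewrite parity-flip j T | ∁-flip j T | f∘flip≗f (∁ T) = refl

  ⊤∈complementsOf-even : ⊤ ∈ˡ complementsOf {n} (not ∘ parity)
  ⊤∈complementsOf-even {n} = ∈-concatMap⁺ (λ T → if not (parity T) then [ ∁ T ] else []) {xs = allSubsets n}
    (Any.map (λ { refl → ⊤∈[∁⊥] }) (∈-allSubsets ⊥))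
    where
    ⊤∈[∁⊥] : ⊤ ∈ˡ (if not (parity (⊥ {n})) then [ ∁ ⊥ ] else [])
    ⊤∈[∁⊥] rewrite parity-⊥ n = here (sym (map-replicate not false n))

  properBlock : Subset n → Bool → List (Subset n)
  properBlock []          t = []
  properBlock (true  ∷ T) t = branch (block T (not t)) (properBlock T t)
  properBlock (false ∷ T) t = map (true ∷_) (properBlock T t)

  block-split : ∀ (T : Subset n) t → block T t ↭ (if t then [] else [ ∁ T ]) ++ properBlock T t
  block-split []          true  = ↭-refl
  block-split []          false = ↭-refl
  block-split (true  ∷ T) t     = ↭-trans (branch⁺ ↭-refl (block-split T t)) (move t)
    where
    move : ∀ t → branch (block T (not t)) ((if t then [] else [ ∁ T ]) ++ properBlock T t)
                 ↭ (if t then [] else [ false ∷ ∁ T ]) ++ properBlock (true ∷ T) t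
    move true  = ↭-refl
    move false = shift (false ∷ ∁ T) (map (true ∷_) (block T true)) _
  block-split (false ∷ T) t     = ↭-trans (map⁺ (true ∷_) (block-split T t))
    (↭-reflexive (trans (map-++ (true ∷_) (if t then [] else [ ∁ T ]) _)
                        (cong (_++ map (true ∷_) (properBlock T t)) (map-if t))))
    where
    map-if : ∀ t → map (true ∷_) (if t then [] else [ ∁ T ]) ≡ (if t then [] else [ true ∷ ∁ T ])
    map-if true  = refl
    map-if false = refl

  ⊤∈block : ∀ (T : Subset n) → ⊤ ∈ˡ block T (parity T)
  ⊤∈block []          = here refl
  ⊤∈block (true  ∷ T) =
    ∈-++⁺ˡ (∈-map⁺ (true ∷_) (subst (λ t → ⊤ ∈ˡ block T t) (sym (not-involutive (parity T))) (⊤∈block T)))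
  ⊤∈block (false ∷ T) = ∈-map⁺ (true ∷_) (⊤∈block T)

  -- The one family whose Droste columns miss the all-black column: 𝔗 ∩ 𝔖 = {T ∈ 𝔖 : |T| even}.
  evenSized? : Family n → Bool
  evenSized? {n} 𝔗 = all (λ T → not (inSb T) ∨ (𝔗 T xor parity T)) (allSubsets n)

  evenSized?-true : ∀ (𝔗 : Family n) → evenSized? 𝔗 ≡ true → ∀ U → InS U → 𝔗 U ≡ not (parity U)
  evenSized?-true {n} 𝔗 even U U∈𝔖 =
    xor⇒≡not (𝔗 U) (parity U) (subst (λ b → T (not b ∨ (𝔗 U xor parity U))) (Equivalence.to T-≡ U∈𝔖)
      (All.lookup (All.all⁺ _ (allSubsets n) (Equivalence.from T-≡ even)) (∈-allSubsets U)))
    where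
    xor⇒≡not : ∀ a b → T (false ∨ (a xor b)) → a ≡ not b
    xor⇒≡not true  false _ = refl
    xor⇒≡not false true  _ = refl

  evenSized?-false : ∀ (𝔗 : Family n) → evenSized? 𝔗 ≡ false → ∃ λ T → InS T × 𝔗 T ≡ parity T
  evenSized?-false {n} 𝔗 notEven with U , _ , clash ← all-false _ (allSubsets n) notEven = U , clash-inS clash
    where
    clash-inS : ∀ {a b c} → not a ∨ (b xor c) ≡ false → T a × b ≡ c
    clash-inS {true} {true}  {true}  _ = _ , refl
    clash-inS {true} {false} {false} _ = _ , refl

  evenSized?-cong : ∀ {𝔗 𝔗′ : Family n} → (∀ T → InS T → 𝔗 T ≡ 𝔗′ T) →
                    evenSized? 𝔗 ≡ evenSized? 𝔗′
  evenSized?-cong {n} {𝔗} {𝔗′} agree = cong and (map-cong pointwise (allSubsets n))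
    where
    pointwise : ∀ T → not (inSb T) ∨ (𝔗 T xor parity T) ≡ not (inSb T) ∨ (𝔗′ T xor parity T)
    pointwise T with inSb T in T∈𝔖
    ... | false = refl
    ... | true  = cong (λ b → b xor parity T) (agree T (Equivalence.from T-≡ T∈𝔖))

  remove⊤ : List (Subset n) → List (Subset n)
  remove⊤ []       = []
  remove⊤ (X ∷ Xs) = if does (X ≟ ⊤) then Xs else X ∷ remove⊤ Xs

  ↭-remove⊤ : ∀ {Xs : List (Subset n)} → ⊤ ∈ˡ Xs → Xs ↭ ⊤ ∷ remove⊤ Xs
  ↭-remove⊤ {Xs = X ∷ Xs} ⊤∈ with X ≟ ⊤ | ⊤∈
  ... | yes refl | _           = ↭-refl
  ... | no X≢⊤  | here ⊤≡X    = contradiction (sym ⊤≡X) X≢⊤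
  ... | no X≢⊤  | there ⊤∈Xs  = ↭-trans (↭-prep X (↭-remove⊤ ⊤∈Xs)) (↭-swap X ⊤ ↭-refl)

  properColumns : Family n → List (Subset n)
  properColumns {n} 𝔗 = concatMap (λ T → if inSb T then properBlock T (𝔗 T) else []) (allSubsets n)

  preColumns : Family n → List (Subset n)
  preColumns 𝔗 = if evenSized? 𝔗 then properColumns 𝔗 ++ complementsOf (not ∘ parity) else drosteColumns 𝔗

  schemeColumns : Family n → List (Subset n)
  schemeColumns 𝔗 = remove⊤ (preColumns 𝔗)

  oddCorrection evenCorrection : Family n → List (Subset n)
  oddCorrection  𝔗 = if evenSized? 𝔗 then complementsOf parity else []
  evenCorrection 𝔗 = if evenSized? 𝔗 then complementsOf (not ∘ parity) else []

  ⊤∈preColumns : ∀ (𝔗 : Family n) → ⊤ ∈ˡ preColumns 𝔗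
  ⊤∈preColumns {n} 𝔗 with evenSized? 𝔗 in even
  ... | true  = ∈-++⁺ʳ (properColumns 𝔗) ⊤∈complementsOf-even
  ... | false with U , U∈𝔖 , clash ← evenSized?-false 𝔗 even =
    ∈-concatMap⁺ (drosteBlock 𝔗) {xs = allSubsets n} (Any.map (λ { refl → ⊤∈drosteBlock }) (∈-allSubsets U))
    where
    ⊤∈drosteBlock : ⊤ ∈ˡ drosteBlock 𝔗 U
    ⊤∈drosteBlock rewrite Equivalence.to T-≡ U∈𝔖 | clash = ⊤∈block U

  drosteColumns-evenSized : parity (⊤ {n}) ≡ false → ∀ (𝔗 : Family n) → evenSized? 𝔗 ≡ true →
                            drosteColumns 𝔗 ↭ complementsOf parity ++ properColumns 𝔗
  drosteColumns-evenSized {n} ⊤-even 𝔗 even = ↭-trans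
    (concatMap-cong-↭ split (allSubsets n))
    (concatMap-++-distrib oddComplement properPart (allSubsets n))
    where
    oddComplement properPart : Subset n → List (Subset n)
    oddComplement T = if parity T then [ ∁ T ] else []
    properPart    T = if inSb T then properBlock T (𝔗 T) else []
    split : ∀ T → drosteBlock 𝔗 T ↭ oddComplement T ++ properPart T
    split T with inSb T in T∈𝔖
    ... | true  rewrite evenSized?-true 𝔗 even T (Equivalence.from T-≡ T∈𝔖) with parity T
    ...   | true  = block-split T false
    ...   | false = block-split T true
    split T | false with ∉𝔖⇒⊥⊎⊤ T T∈𝔖
    ...   | inj₁ refl rewrite parity-⊥ n = ↭-refl
    ...   | inj₂ refl rewrite ⊤-even     = ↭-refl

  schemeColumns-balance : parity (⊤ {n}) ≡ false → ∀ (𝔗 : Family n) →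
                          ⊤ ∷ schemeColumns 𝔗 ++ oddCorrection 𝔗 ↭ drosteColumns 𝔗 ++ evenCorrection 𝔗
  schemeColumns-balance ⊤-even 𝔗 =
    ↭-trans (++⁺ʳ (oddCorrection 𝔗) (↭-sym (↭-remove⊤ (⊤∈preColumns 𝔗)))) (balance (evenSized? 𝔗) refl)
    where
    balance : ∀ b → evenSized? 𝔗 ≡ b →
              preColumns 𝔗 ++ oddCorrection 𝔗 ↭ drosteColumns 𝔗 ++ evenCorrection 𝔗
    balance false even rewrite even = ↭-refl
    balance true  even rewrite even = begin
      (properColumns 𝔗 ++ complementsOf (not ∘ parity)) ++ complementsOf parity
        ↭⟨ ++-comm (properColumns 𝔗 ++ _) (complementsOf parity) ⟩
      complementsOf parity ++ (properColumns 𝔗 ++ complementsOf (not ∘ parity))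
        ≡⟨ ++-assoc (complementsOf parity) (properColumns 𝔗) _ ⟨
      (complementsOf parity ++ properColumns 𝔗) ++ complementsOf (not ∘ parity)
        ↭⟨ ++⁺ʳ _ (drosteColumns-evenSized ⊤-even 𝔗 even) ⟨
      drosteColumns 𝔗 ++ complementsOf (not ∘ parity) ∎
      where open PermutationReasoning

  map-corrections-flip : ∀ (𝔗 : Family n) (j : Fin n) {f : Subset n → B} → (∀ X → f (flip j X) ≡ f X) →
                         map f (oddCorrection 𝔗) ↭ map f (evenCorrection 𝔗)
  map-corrections-flip 𝔗 j f∘flip≗f with evenSized? 𝔗
  ... | true  = map-complements-flip j f∘flip≗f
  ... | false = ↭-refl

  -- Pads with ⊥; only ever applied to lists of length m.
  toColumnVector : (m : ℕ) → List (Subset n) → Vec (Subset n) m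
  toColumnVector zero    _        = []
  toColumnVector (suc m) []       = ⊥ ∷ toColumnVector m []
  toColumnVector (suc m) (X ∷ Xs) = X ∷ toColumnVector m Xs

  countᵇ-toColumnVector : ∀ (p : Subset n → Bool) (Xs : List (Subset n)) →
                          countᵇ p (toColumnVector (length Xs) Xs) ≡ count p Xs
  countᵇ-toColumnVector p []       = refl
  countᵇ-toColumnVector p (X ∷ Xs) with p X
  ... | true  = cong suc (countᵇ-toColumnVector p Xs)
  ... | false = countᵇ-toColumnVector p Xs

  toColumnVector-∩ : ∀ m (Q : Subset n) Xs →
                     toColumnVector m (map (Q ∩_) Xs) ≡ Vec.map (Q ∩_) (toColumnVector m Xs)
  toColumnVector-∩ zero    Q Xs       = refl
  toColumnVector-∩ (suc m) Q []       = cong₂ _∷_ (sym (∩-zeroʳ Q)) (toColumnVector-∩ m Q [])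
  toColumnVector-∩ (suc m) Q (X ∷ Xs) = cong (Q ∩ X ∷_) (toColumnVector-∩ m Q Xs)

  module EvenConstruction {k : ℕ} (⊤-even : parity (⊤ {suc k}) ≡ false) where

    private
      N = suc k

    length-schemeColumns : ∀ (𝔗 : Family N) → suc (length (schemeColumns 𝔗)) ≡ drosteExpansion N
    length-schemeColumns 𝔗 = trans (+-cancelʳ-≡ _ _ _ (begin
      suc (length (schemeColumns 𝔗)) + length (oddCorrection 𝔗)
        ≡⟨ length-++ (⊤ ∷ schemeColumns 𝔗) ⟨
      length (⊤ ∷ schemeColumns 𝔗 ++ oddCorrection 𝔗)
        ≡⟨ ↭-length (schemeColumns-balance ⊤-even 𝔗) ⟩
      length (drosteColumns 𝔗 ++ evenCorrection 𝔗)
        ≡⟨ length-++ (drosteColumns 𝔗) ⟩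
      length (drosteColumns 𝔗) + length (evenCorrection 𝔗)
        ≡⟨ cong (length (drosteColumns 𝔗) +_) corrections ⟨
      length (drosteColumns 𝔗) + length (oddCorrection 𝔗) ∎))
      (length-drosteColumns 𝔗)
      where
      open ≡-Reasoning
      corrections : length (oddCorrection 𝔗) ≡ length (evenCorrection 𝔗)
      corrections = trans (sym (length-map (λ _ → true) (oddCorrection 𝔗)))
        (trans (↭-length (map-corrections-flip 𝔗 zero {f = λ _ → true} (λ _ → refl)))
               (length-map _ (evenCorrection 𝔗)))

    count-meets-schemeColumns : ∀ (𝔗 : Family N) S → InS S →
                                suc (count (meets S) (schemeColumns 𝔗)) ≡ count (meets S) (drosteColumns 𝔗)
    count-meets-schemeColumns 𝔗 S S∈𝔖
      with i , i∈S ← InS⇒Nonempty S S∈𝔖 | j , j∈∁S ← InS⇒Nonempty∁ S S∈𝔖 = +-cancelʳ-≡ _ _ _ (begin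
      suc (count (meets S) (schemeColumns 𝔗)) + count (meets S) (oddCorrection 𝔗)
        ≡⟨ cong (λ b → (if b then 1 else 0) + count (meets S) (schemeColumns 𝔗) + count (meets S) (oddCorrection 𝔗))
                (meets-∈ i∈S ∈⊤) ⟨
      count (meets S) (⊤ ∷ schemeColumns 𝔗) + count (meets S) (oddCorrection 𝔗)
        ≡⟨ count-++ (meets S) (⊤ ∷ schemeColumns 𝔗) _ ⟨
      count (meets S) (⊤ ∷ schemeColumns 𝔗 ++ oddCorrection 𝔗)
        ≡⟨ count-↭ (meets S) (schemeColumns-balance ⊤-even 𝔗) ⟩
      count (meets S) (drosteColumns 𝔗 ++ evenCorrection 𝔗)
        ≡⟨ count-++ (meets S) (drosteColumns 𝔗) _ ⟩
      count (meets S) (drosteColumns 𝔗) + count (meets S) (evenCorrection 𝔗)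
        ≡⟨ cong (count (meets S) (drosteColumns 𝔗) +_)
                (count-↭-map (meets S) (map-corrections-flip 𝔗 j (meets-flip (x∈∁p⇒x∉p j∈∁S)))) ⟨
      count (meets S) (drosteColumns 𝔗) + count (meets S) (oddCorrection 𝔗) ∎)
      where open ≡-Reasoning

    masked-balance : ∀ (Q : Subset N) 𝔗 →
      map (Q ∩_) (⊤ ∷ schemeColumns 𝔗) ++ map (Q ∩_) (oddCorrection 𝔗)
      ↭ map (Q ∩_) (drosteColumns 𝔗) ++ map (Q ∩_) (evenCorrection 𝔗)
    masked-balance Q 𝔗 = ↭-trans (↭-reflexive (sym (map-++ (Q ∩_) (⊤ ∷ schemeColumns 𝔗) _)))
      (↭-trans (map⁺ (Q ∩_) (schemeColumns-balance ⊤-even 𝔗))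
               (↭-reflexive (map-++ (Q ∩_) (drosteColumns 𝔗) _)))

    ∩-schemeColumns : ∀ (Q : Subset N) {𝔗 𝔗′} → AgreeOn Q 𝔗 𝔗′ →
                      map (Q ∩_) (schemeColumns 𝔗) ↭ map (Q ∩_) (schemeColumns 𝔗′)
    ∩-schemeColumns Q {𝔗} {𝔗′} agree with ⊆-or-witness ⊤ Q
    ... | inj₂ (j , _ , j∉Q) = drop-∷ (begin
      M (⊤ ∷ schemeColumns 𝔗)   ↭⟨ masked-droste 𝔗 ⟩
      M (drosteColumns 𝔗)       ↭⟨ ∩-drosteColumns Q agree ⟩
      M (drosteColumns 𝔗′)      ↭⟨ masked-droste 𝔗′ ⟨
      M (⊤ ∷ schemeColumns 𝔗′)  ∎)
      where
      open PermutationReasoning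
      M = map (Q ∩_)
      masked-droste : ∀ 𝔗 → M (⊤ ∷ schemeColumns 𝔗) ↭ M (drosteColumns 𝔗)
      masked-droste 𝔗 = ++-cancelʳ (M (oddCorrection 𝔗)) (begin
        M (⊤ ∷ schemeColumns 𝔗) ++ M (oddCorrection 𝔗)   ↭⟨ masked-balance Q 𝔗 ⟩
        M (drosteColumns 𝔗) ++ M (evenCorrection 𝔗)       ↭⟨ ++⁺ˡ _ (map-corrections-flip 𝔗 j (∩-flip j∉Q)) ⟨
        M (drosteColumns 𝔗) ++ M (oddCorrection 𝔗)        ∎)
    ... | inj₁ ⊤⊆Q = drop-∷ (++-cancelʳ (M (oddCorrection 𝔗)) (begin
      M (⊤ ∷ schemeColumns 𝔗) ++ M (oddCorrection 𝔗)
        ↭⟨ masked-balance Q 𝔗 ⟩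
      M (drosteColumns 𝔗) ++ M (evenCorrection 𝔗)
        ↭⟨ ++⁺ʳ _ (∩-drosteColumns Q agree) ⟩
      M (drosteColumns 𝔗′) ++ M (evenCorrection 𝔗)
        ≡⟨ cong (λ b → M (drosteColumns 𝔗′) ++ M (if b then complementsOf (not ∘ parity) else [])) same ⟩
      M (drosteColumns 𝔗′) ++ M (evenCorrection 𝔗′)
        ↭⟨ masked-balance Q 𝔗′ ⟨
      M (⊤ ∷ schemeColumns 𝔗′) ++ M (oddCorrection 𝔗′)
        ≡⟨ cong (λ b → M (⊤ ∷ schemeColumns 𝔗′) ++ M (if b then complementsOf parity else [])) same ⟨
      M (⊤ ∷ schemeColumns 𝔗′) ++ M (oddCorrection 𝔗) ∎))
      where
      open PermutationReasoning
      M = map (Q ∩_)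
      same : evenSized? 𝔗 ≡ evenSized? 𝔗′
      same = evenSized?-cong λ T T∈𝔖 → agree T T∈𝔖 (λ j∈T → ⊤⊆Q ∈⊤)

    m : ℕ
    m = pred (drosteExpansion N)

    length-schemeColumns≡m : ∀ 𝔗 → length (schemeColumns 𝔗) ≡ m
    length-schemeColumns≡m 𝔗 = cong pred (length-schemeColumns 𝔗)

    matrixOf : List (Subset N) → Matrix N m
    matrixOf Xs = fromColumns (toColumnVector m Xs)

    𝔗₀ : Family N
    𝔗₀ _ = false

    lowerWeight : Subset N → ℕ
    lowerWeight S = count (meets S) (schemeColumns 𝔗₀)

    count-meets-schemeColumns-≡ : ∀ 𝔗 S → InS S →
      count (meets S) (schemeColumns 𝔗) ≡ (if 𝔗 S then suc (lowerWeight S) else lowerWeight S)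
    count-meets-schemeColumns-≡ 𝔗 S S∈𝔖 with 𝔗 S | count-meets-drosteColumns 𝔗 S S∈𝔖
    ... | true  | eq = suc-injective (trans (count-meets-schemeColumns 𝔗 S S∈𝔖)
                         (trans eq (cong suc (sym (count-meets-schemeColumns 𝔗₀ S S∈𝔖)))))
    ... | false | eq = suc-injective (trans (count-meets-schemeColumns 𝔗 S S∈𝔖)
                         (trans eq (sym (count-meets-schemeColumns 𝔗₀ S S∈𝔖))))

    weight-matrixOf : ∀ 𝔗 {π} → π ∈ˡ permutations (schemeColumns 𝔗) → ∀ S → InS S →
                      weight (orRows S (matrixOf π)) ≡ (if 𝔗 S then suc (lowerWeight S) else lowerWeight S)
    weight-matrixOf 𝔗 {π} π∈ S S∈𝔖 = begin
      weight (orRows S (matrixOf π))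
        ≡⟨ weight-orRows S (matrixOf π) ⟩
      countᵇ (meets S) (columns (matrixOf π))
        ≡⟨ cong (countᵇ (meets S)) (columns-fromColumns (toColumnVector m π)) ⟩
      countᵇ (meets S) (toColumnVector m π)
        ≡⟨ cong (λ l → countᵇ (meets S) (toColumnVector l π)) length-π ⟨
      countᵇ (meets S) (toColumnVector (length π) π)
        ≡⟨ countᵇ-toColumnVector (meets S) π ⟩
      count (meets S) π
        ≡⟨ count-↭ (meets S) π↭ ⟩
      count (meets S) (schemeColumns 𝔗)
        ≡⟨ count-meets-schemeColumns-≡ 𝔗 S S∈𝔖 ⟩
      (if 𝔗 S then suc (lowerWeight S) else lowerWeight S) ∎
      where
      open ≡-Reasoning
      π↭ : π ↭ schemeColumns 𝔗
      π↭ = ∈-permutations⁻ (schemeColumns 𝔗) π∈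
      length-π : length π ≡ m
      length-π = trans (↭-length π↭) (length-schemeColumns≡m 𝔗)

    restrict-matrixOf : ∀ (Q : Subset N) Xs → restrict Q (matrixOf Xs) ≡ restrict Q (matrixOf (map (Q ∩_) Xs))
    restrict-matrixOf Q Xs = trans (restrict-fromColumns-∩ Q (toColumnVector m Xs))
                                   (cong (restrict Q ∘ fromColumns) (sym (toColumnVector-∩ m Q Xs)))

    restrict-permutations : ∀ (Q : Subset N) Xs →
      map (restrict Q) (map matrixOf (permutations Xs)) ≡ map (restrict Q ∘ matrixOf) (permutations (map (Q ∩_) Xs))
    restrict-permutations Q Xs = begin
      map (restrict Q) (map matrixOf (permutations Xs))
        ≡⟨ map-∘ (permutations Xs) ⟨
      map (restrict Q ∘ matrixOf) (permutations Xs)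
        ≡⟨ map-cong (restrict-matrixOf Q) (permutations Xs) ⟩
      map (restrict Q ∘ matrixOf ∘ map (Q ∩_)) (permutations Xs)
        ≡⟨ map-∘ (permutations Xs) ⟩
      map (restrict Q ∘ matrixOf) (map (map (Q ∩_)) (permutations Xs))
        ≡⟨ cong (map (restrict Q ∘ matrixOf)) (permutations-map (Q ∩_) Xs) ⟨
      map (restrict Q ∘ matrixOf) (permutations (map (Q ∩_) Xs)) ∎
      where open ≡-Reasoning

    scheme : Scheme N m
    scheme = record
      { l        = lowerWeight
      ; h        = suc ∘ lowerWeight
      ; l≤h      = λ S _ → n≤1+n (lowerWeight S)
      ; h≤m      = h≤m
      ; C        = λ 𝔗 → map matrixOf (permutations (schemeColumns 𝔗))
      ; nonempty = λ 𝔗 _ → ∈⇒≢[] (∈-map⁺ matrixOf (∈-permutations-self (schemeColumns 𝔗)))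
      ; weights  = weights
      ; security = λ Q 𝔗 𝔗′ _ _ agree → subst₂ _↭_ (sym (restrict-permutations Q (schemeColumns 𝔗)))
                                                   (sym (restrict-permutations Q (schemeColumns 𝔗′)))
                     (map⁺ (restrict Q ∘ matrixOf) (permutations-↭ (∩-schemeColumns Q agree)))
      }
      where
      h≤m : ∀ S → InS S → suc (lowerWeight S) ≤ m
      h≤m S S∈𝔖 = subst₂ _≤_
        (trans (count-meets-schemeColumns-≡ [S] S S∈𝔖)
               (cong (λ b → if b then suc (lowerWeight S) else lowerWeight S) (dec-true (S ≟ S) refl)))
        (length-schemeColumns≡m [S])
        (count-≤-length (meets S) (schemeColumns [S]))
        where
        [S] : Family N
        [S] T = does (T ≟ S)
      weights : ∀ 𝔗 → IsSubFamily 𝔗 → ∀ B → B ∈ˡ map matrixOf (permutations (schemeColumns 𝔗)) → ∀ S → InS S →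
                weight (orRows S B) ≡ (if 𝔗 S then suc (lowerWeight S) else lowerWeight S)
      weights 𝔗 _ B B∈ S S∈𝔖 with π , π∈ , refl ← ∈-map⁻ matrixOf B∈ = weight-matrixOf 𝔗 π∈ S S∈𝔖

    positiveContrast : PositiveContrast scheme
    positiveContrast S _ = n<1+n (lowerWeight S)

    m<drosteExpansion : m < drosteExpansion N
    m<drosteExpansion = subst (m <_) (length-schemeColumns 𝔗₀)
      (subst (λ l → l < suc (length (schemeColumns 𝔗₀))) (length-schemeColumns≡m 𝔗₀) (n<1+n _))

open import Data.Bool.Properties using (not-involutive)
open import Data.Nat using (_+_; _*_; _∸_; _^_; _≤_; _<_; _%_; s≤s)
open import Data.Nat.DivMod using ([m+n]%n≡m%n)
open import Data.Nat.Properties using (+-comm; <⇒≱)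
open import Function.Bundles using (_⇔_; mk⇔)

%2≡parity : ∀ n → n % 2 ≡ (if parity (⊤ {n}) then 1 else 0)
%2≡parity zero          = refl
%2≡parity (suc zero)    = refl
%2≡parity (suc (suc n)) = trans (cong (_% 2) (+-comm 2 n)) (trans ([m+n]%n≡m%n n 2)
  (trans (%2≡parity n) (cong (λ b → if b then 1 else 0) (sym (not-involutive (parity (⊤ {n})))))))

odd⇒parity : ∀ n → n % 2 ≡ 1 → parity (⊤ {n}) ≡ true
odd⇒parity n odd with parity (⊤ {n}) | %2≡parity n
... | true  | _    = refl
... | false | even = contradiction (trans (sym odd) even) λ ()

even⇒parity : ∀ n → n % 2 ≡ 0 → parity (⊤ {n}) ≡ false
even⇒parity n even with parity (⊤ {n}) | %2≡parity n
... | false | _   = refl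
... | true  | odd = contradiction (trans (sym even) odd) λ ()

mainTheorem5 : (n : ℕ) → 2 ≤ n →
    (2 * drosteExpansion n + 2 ^ n ≡ 3 ^ n ∸ 1)
    × (DrosteOptimal n ⇔ (n % 2 ≡ 1))
    × (n % 2 ≡ 0 → Σ ℕ λ m → Σ (Scheme n m) λ S → PositiveContrast S × m < drosteExpansion n)
mainTheorem5 (suc k) (s≤s _) =
  drosteExpansion-closedForm k , mk⇔ optimal⇒odd odd⇒optimal , shorter ∘ even⇒parity n
  where
  n = suc k
  shorter : parity (⊤ {n}) ≡ false → Σ ℕ λ m → Σ (Scheme n m) λ S → PositiveContrast S × m < drosteExpansion n
  shorter ⊤-even = m , scheme , positiveContrast , m<drosteExpansion
    where open EvenConstruction {k} ⊤-even
  odd⇒optimal : n % 2 ≡ 1 → DrosteOptimal n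
  odd⇒optimal odd m 𝒮 contrast = drosteExpansion≤ 𝒮 contrast (odd⇒parity n odd)
  optimal⇒odd : DrosteOptimal n → n % 2 ≡ 1
  optimal⇒odd optimal with parity (⊤ {n}) in ⊤-parity | %2≡parity n
  ... | true  | odd = odd
  ... | false | _ with m , 𝒮 , contrast , m<D ← shorter ⊤-parity = contradiction (optimal m 𝒮 contrast) (<⇒≱ m<D)
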